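{- Let $0<\alpha \le 1/8$ and let $\mathsf{Halver}$ be a data-oblivious $\alpha$-halver procedure operating on pairs of equal-sized arrays whose size is a power of $2$. Then the procedure $\mathsf{Attenuate}$ (defined in the context, built from $\mathsf{Halver}$), when prefaced by an $\alpha$-halver operation $\mathsf{Halver}(A,B)$ on its input pair $(A,B)$, is an $\epsilon$-halver for $\epsilon = \alpha^2(\lceil \log_2(1/\alpha)\rceil + 3)$.
   Context: A compare-exchange on positions $(p,q)$ replaces the values $(x,y)$ there by $(\min(x,y),\max(x,y))$; a procedure is data-oblivious if its sequence of compare-exchanges/memory accesses is independent of the input values. For $\epsilon\ge0$, an $\epsilon$-halver is a data-oblivious procedure that, given arrays $(A,B)$ each of size $n$, performs compare-exchanges so that afterwards, for every $k\le n$, at most $\epsilon k$ of the $k$ largest elements of $A\cup B$ are in $A$ and at most $\epsilon k$ of the $k$ smallest are in $B$. "Sort $A\cup B$" means rearranging the $2n$ items so that the concatenation $AB$ is in nondecreasing order; "partition $E$ into halves $F,G$" means viewing the first half of subarray $E$ as $F$ and the second half as $G$. Procedure $\mathsf{Attenuate}(A,B)$, with $|A|=|B|=n$ a power of 2: if $n\le 8$, sort $A\cup B$ and return. Otherwise partition $A$ into halves $A_1,A_2$ and $B$ into halves $B_1,B_2$; run $\mathsf{Halver}(A_1,A_2)$, $\mathsf{Halver}(B_1,B_2)$, $\mathsf{Halver}(A_2,B_1)$, then $\mathsf{Attenuate}(A_2,B_1)$; then partition $A_2$ into halves $A_{21},A_{22}$ and $B_1$ into halves $B_{11},B_{12}$;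 run $\mathsf{Halver}(A_{21},A_{22})$, $\mathsf{Halver}(B_{11},B_{12})$, $\mathsf{Halver}(A_{22},B_{11})$, then $\mathsf{Attenuate}(A_{22},B_{11})$. -}

module Defs where

open import Data.Nat as ℕ using (ℕ; zero; suc; _+_; _^_; _≡ᵇ_; _<ᵇ_; _⊓_; _⊔_)
open import Data.Bool using (Bool; true; false; if_then_else_)
open import Data.Fin using (Fin; toℕ)
open import Data.Product using (_×_; _,_)
open import Data.List using (List; []; _∷_; _++_; map; concat)
open import Data.Integer using (+_)
open import Data.Rational using (ℚ; _/_; _*_; _≤_; _<_; 1ℚ)
open import Relation.Binary.PropositionalEquality using (_≡_)

-- An array is a function ℕ → ℕ (positions → values); only positions
-- below the array length are meaningful.

Comparator : Set
Comparator = ℕ × ℕ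

Network : Set
Network = List Comparator

cex : Comparator → (ℕ → ℕ) → (ℕ → ℕ)
cex (p , q) f i =
  if i ≡ᵇ p then f p ⊓ f q
  else (if i ≡ᵇ q then f p ⊔ f q else f i)

run : Network → (ℕ → ℕ) → (ℕ → ℕ)
run []      f = f
run (c ∷ cs) f = run cs (cex c f)

toNet : {m : ℕ} → List (Fin m × Fin m) → Network
toNet = map (λ { (p , q) → (toℕ p , toℕ q) })

shift : ℕ → Network → Network
shift o = map (λ { (p , q) → (o + p , o + q) })

count : (ℕ → Bool) → ℕ → ℕ
count P zero    = 0
count P (suc m) = count P m + (if P m then 1 else 0)

nGreater : (ℕ → ℕ) → ℕ → ℕ → ℕ
nGreater g m i = count (λ j → g i <ᵇ g j) m

nSmaller : (ℕ → ℕ) → ℕ → ℕ → ℕ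
nSmaller g m i = count (λ j → g j <ᵇ g i) m

DistinctOn : ℕ → (ℕ → ℕ) → Set
DistinctOn m f = ∀ i j → i ℕ.< m → j ℕ.< m → f i ≡ f j → i ≡ j

-- ε-halver on arrays (A , B) of size n each, laid out as A = positions
-- [0, n) and B = positions [n, 2n).  The element at position i is among
-- the k largest iff fewer than k elements are strictly larger than it
-- (and symmetrically for the k smallest).

ℕtoℚ : ℕ → ℚ
ℕtoℚ k = + k / 1

IsHalver : ℚ → ℕ → Network → Set
IsHalver ε n N =
  ∀ (f : ℕ → ℕ) → DistinctOn (n + n) f →
  ∀ k → k ℕ.≤ n →
    let g = run N f in
      (ℕtoℚ (count (λ i → nGreater g (n + n) i <ᵇ k) n) ≤ ε * ℕtoℚ k)
    × (ℕtoℚ (count (λ i → nSmaller g (n + n) (n + i) <ᵇ k) n) ≤ ε * ℕtoℚ k)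

-- Sorting network used for the base case "sort A ∪ B" (bubble sort:
-- m rounds of adjacent compare-exchanges (i , i+1), i + 1 < m).

adjacent : ℕ → Network
adjacent zero          = []
adjacent (suc zero)    = []
adjacent (suc (suc m)) = adjacent (suc m) ++ ((m , suc m) ∷ [])

bubble : ℕ → Network
bubble m = rounds m
  where
  rounds : ℕ → Network
  rounds zero    = []
  rounds (suc r) = adjacent m ++ rounds r

HalverFamily : Set
HalverFamily = (k : ℕ) → List (Fin (2 ^ k + 2 ^ k) × Fin (2 ^ k + 2 ^ k))

-- Attenuate(A , B) with |A| = |B| = 2^k, acting on positions [0, 2^(k+1)).
-- With h = 2^j (k = j + 1) and q = 2^(j-1):
--   A1 = [0,h), A2 = [h,2h), B1 = [2h,3h), B2 = [3h,4h),
--   A21 = [h,h+q), A22 = [h+q,2h), B11 = [2h,2h+q), B12 = [2h+q,3h).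
attenuate : HalverFamily → ℕ → Network
attenuate H zero                      = bubble (2 ^ 0 + 2 ^ 0)
attenuate H (suc zero)                = bubble (2 ^ 1 + 2 ^ 1)
attenuate H (suc (suc zero))          = bubble (2 ^ 2 + 2 ^ 2)
attenuate H (suc (suc (suc zero)))    = bubble (2 ^ 3 + 2 ^ 3)
attenuate H (suc (suc (suc (suc i)))) =
     shift 0       (toNet (H j))       -- Halver(A1, A2)
  ++ shift (h + h) (toNet (H j))       -- Halver(B1, B2)
  ++ shift h       (toNet (H j))       -- Halver(A2, B1)
  ++ shift h       (attenuate H (suc (suc (suc i))))     -- Attenuate(A2, B1)
  ++ shift h       (toNet (H l))       -- Halver(A21, A22)
  ++ shift (h + h) (toNet (H l))       -- Halver(B11, B12)
  ++ shift (h + q) (toNet (H l))       -- Halver(A22, B11)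
  ++ shift (h + q) (attenuate H (suc (suc i)))     -- Attenuate(A22, B11)
  where
  j = suc (suc (suc i))
  l = suc (suc i)
  h = 2 ^ j
  q = 2 ^ l

halveThenAttenuate : HalverFamily → ℕ → Network
halveThenAttenuate H k = toNet (H k) ++ attenuate H k

-- m = ⌈log₂ (1/α)⌉ for α > 0: the least m with 2^m ≥ 1/α, i.e. α·2^m ≥ 1
IsCeilLog2Inv : ℚ → ℕ → Set
IsCeilLog2Inv α m =
  (1ℚ ≤ α * ℕtoℚ (2 ^ m)) × (∀ j → j ℕ.< m → α * ℕtoℚ (2 ^ j) < 1ℚ)

-- Comparator networks commute with monotone maps, so a network is an ε-halver exactly
-- when, for every threshold, at most ε·t of the t ones of the thresholded input stay in A
-- when t ≤ n, and dually for zeros in B. In this form Halver(A, B) followed by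
-- Attenuate(A, B) is a 6α²-halver, by induction on n: small sizes are sorted outright,
-- and otherwise the ones left in A are those left in A₁ by Halver(A₁, A₂), in A₂₁ by
-- Halver(A₂₁, A₂₂) and in A₂₂ by the recursive call on (A₂₂, B₁₁). Bounding each of
-- them by the halver property of its stage gives a system of linear inequalities from
-- which the bound follows by a case analysis on which stages see more than half ones.
-- Finally α ≤ 1/8 forces ⌈log₂(1/α)⌉ ≥ 3, so 6α² ≤ α²(⌈log₂(1/α)⌉ + 3).

module Submission where

module BoolComparisons where

  open import Data.Nat using (zero; suc; _≤_; _<_; _≡ᵇ_; _<ᵇ_; _≤ᵇ_)
  open import Data.Nat.Properties using (≡ᵇ⇒≡; <ᵇ⇒<; <⇒<ᵇ; ≤ᵇ⇒≤; ≤⇒≤ᵇ)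
  open import Data.Bool using (true; false; T)
  open import Data.Bool.Properties using (T-≡)
  open import Data.Empty using (⊥-elim)
  open import Function.Bundles using (Equivalence)
  open import Relation.Nullary using (¬_)
  open import Relation.Binary.PropositionalEquality

  private
    T⇒≡true : ∀ {b} → T b → b ≡ true
    T⇒≡true = Equivalence.to T-≡

    ≡true⇒T : ∀ {b} → b ≡ true → T b
    ≡true⇒T = Equivalence.from T-≡

    ¬T⇒≡false : ∀ {b} → ¬ T b → b ≡ false
    ¬T⇒≡false {false} _  = refl
    ¬T⇒≡false {true}  ¬T = ⊥-elim (¬T _)

  true≢false : true ≢ false
  true≢false ()

  ≡ᵇ-refl : ∀ n → (n ≡ᵇ n) ≡ true
  ≡ᵇ-refl zero    = refl
  ≡ᵇ-refl (suc n) = ≡ᵇ-refl n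

  ≢⇒≡ᵇ-false : ∀ {m n} → m ≢ n → (m ≡ᵇ n) ≡ false
  ≢⇒≡ᵇ-false {m} {n} m≢n = ¬T⇒≡false (λ T[m≡ᵇn] → m≢n (≡ᵇ⇒≡ m n T[m≡ᵇn]))

  <⇒<ᵇ-true : ∀ {m n} → m < n → (m <ᵇ n) ≡ true
  <⇒<ᵇ-true m<n = T⇒≡true (<⇒<ᵇ m<n)

  ≮⇒<ᵇ-false : ∀ {m n} → ¬ m < n → (m <ᵇ n) ≡ false
  ≮⇒<ᵇ-false m≮n = ¬T⇒≡false (λ T[m<ᵇn] → m≮n (<ᵇ⇒< _ _ T[m<ᵇn]))

  <ᵇ-true⇒< : ∀ {m n} → (m <ᵇ n) ≡ true → m < n
  <ᵇ-true⇒< m<ᵇn = <ᵇ⇒< _ _ (≡true⇒T m<ᵇn)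

  ≤⇒≤ᵇ-true : ∀ {m n} → m ≤ n → (m ≤ᵇ n) ≡ true
  ≤⇒≤ᵇ-true m≤n = T⇒≡true (≤⇒≤ᵇ m≤n)

  ≰⇒≤ᵇ-false : ∀ {m n} → ¬ m ≤ n → (m ≤ᵇ n) ≡ false
  ≰⇒≤ᵇ-false m≰n = ¬T⇒≡false (λ T[m≤ᵇn] → m≰n (≤ᵇ⇒≤ _ _ T[m≤ᵇn]))

  ≤ᵇ-true⇒≤ : ∀ {m n} → (m ≤ᵇ n) ≡ true → m ≤ n
  ≤ᵇ-true⇒≤ m≤ᵇn = ≤ᵇ⇒≤ _ _ (≡true⇒T m≤ᵇn)

module RationalArith where

  open import Data.Nat as ℕ using (ℕ; zero; suc)
  import Data.Nat.Properties as ℕ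
  import Data.Integer as ℤ
  import Data.Integer.Properties as ℤ
  open import Data.Integer using (+_)
  open import Data.Rational
  open import Data.Rational.Properties
  open import Data.Nat.Coprimality using (1-coprimeTo) renaming (sym to coprime-sym)
  open import Data.Maybe using (Maybe; just; nothing)
  open import Data.Product using (_,_)
  open import Data.Sum using (inj₁; inj₂)
  open import Data.Empty using (⊥-elim)
  open import Relation.Nullary using (yes; no)
  open import Relation.Binary.PropositionalEquality
  open import Tactic.RingSolver.Core.AlmostCommutativeRing using (AlmostCommutativeRing; fromCommutativeRing)
  open import Algebra.Properties.AbelianGroup +-0-abelianGroup using (xyx⁻¹≈y)
  open import Defs using (ℕtoℚ)

  ℚ-ring : AlmostCommutativeRing _ _
  ℚ-ring = fromCommutativeRing +-*-commutativeRing isZero?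
    where
    isZero? : ∀ x → Maybe (0ℚ ≡ x)
    isZero? x with 0ℚ ≟ x
    ... | yes p = just p
    ... | no _ = nothing

  ℕtoℚ-suc : ∀ n → ℕtoℚ (suc n) ≡ 1ℚ + ℕtoℚ n
  ℕtoℚ-suc n = begin
    + suc n / 1                               ≡⟨ /-cong {+ suc n} {1} {+ 1 ℤ.* + 1 ℤ.+ + n ℤ.* + 1} {1}
                                                   (cong (λ x → + 1 ℤ.+ x) (sym (ℤ.*-identityʳ (+ n)))) refl ⟩
    1ℚ + mkℚ (+ n) 0 (coprime-sym (1-coprimeTo n)) ≡⟨ cong (λ x → 1ℚ + x) (sym (normalize-coprime (coprime-sym (1-coprimeTo n)))) ⟩
    1ℚ + ℕtoℚ n                                ∎
    where open ≡-Reasoning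

  ℕtoℚ-+ : ∀ m n → ℕtoℚ (m ℕ.+ n) ≡ ℕtoℚ m + ℕtoℚ n
  ℕtoℚ-+ zero    n = sym (+-identityˡ (ℕtoℚ n))
  ℕtoℚ-+ (suc m) n = begin
    ℕtoℚ (suc (m ℕ.+ n))           ≡⟨ ℕtoℚ-suc (m ℕ.+ n) ⟩
    1ℚ + ℕtoℚ (m ℕ.+ n)            ≡⟨ cong (λ x → 1ℚ + x) (ℕtoℚ-+ m n) ⟩
    1ℚ + (ℕtoℚ m + ℕtoℚ n)         ≡⟨ sym (+-assoc 1ℚ (ℕtoℚ m) (ℕtoℚ n)) ⟩
    1ℚ + ℕtoℚ m + ℕtoℚ n           ≡⟨ cong (_+ ℕtoℚ n) (sym (ℕtoℚ-suc m)) ⟩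
    ℕtoℚ (suc m) + ℕtoℚ n          ∎
    where open ≡-Reasoning

  ℕtoℚ-complement : ∀ x y {z} → x ℕ.+ y ≡ z → ℕtoℚ y ≡ ℕtoℚ z - ℕtoℚ x
  ℕtoℚ-complement x y x+y≡z =
    trans (sym (xyx⁻¹≈y (ℕtoℚ x) (ℕtoℚ y))) (cong (_- ℕtoℚ x) (trans (sym (ℕtoℚ-+ x y)) (cong ℕtoℚ x+y≡z)))

  ℕtoℚ-nonNeg : ∀ n → 0ℚ ≤ ℕtoℚ n
  ℕtoℚ-nonNeg n = nonNegative⁻¹ (ℕtoℚ n) {{normalize-nonNeg n 1}}

  n/d-nonNeg : ∀ n d .{{_ : ℕ.NonZero d}} → 0ℚ ≤ + n / d
  n/d-nonNeg n d = nonNegative⁻¹ (+ n / d) {{normalize-nonNeg n d}}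

  infixr 6 _⊕_
  infixr 7 _⊗_

  _⊕_ : ∀ {a b} → 0ℚ ≤ a → 0ℚ ≤ b → 0ℚ ≤ a + b
  _⊕_ = +-mono-≤

  _⊗_ : ∀ {a b} → 0ℚ ≤ a → 0ℚ ≤ b → 0ℚ ≤ a * b
  _⊗_ {a} {b} p q =
    nonNegative⁻¹ (a * b) {{nonNeg*nonNeg⇒nonNeg a {{nonNegative p}} b {{nonNegative q}}}}

  *-monoˡ-≤-0≤ : ∀ {c a b} → 0ℚ ≤ c → a ≤ b → c * a ≤ c * b
  *-monoˡ-≤-0≤ {c} 0≤c = *-monoˡ-≤-nonNeg c {{nonNegative 0≤c}}

  -- Every linear inequality below is proved by exhibiting its slack as a sum of
  -- products of known nonnegative quantities and checking the identity with the ring solver.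
  ≤-by-slack : ∀ {l r x} → 0ℚ ≤ x → l + x ≡ r → l ≤ r
  ≤-by-slack {l} {r} {x} 0≤x l+x≡r = begin
    l       ≡⟨ sym (+-identityʳ l) ⟩
    l + 0ℚ  ≤⟨ +-monoʳ-≤ l 0≤x ⟩
    l + x   ≡⟨ l+x≡r ⟩
    r       ∎
    where open ≤-Reasoning

  slack : ∀ {a b} → a ≤ b → 0ℚ ≤ b - a
  slack {a} {b} a≤b = begin
    0ℚ      ≡⟨ sym (+-inverseʳ a) ⟩
    a - a   ≤⟨ +-monoˡ-≤ (- a) a≤b ⟩
    b - a   ∎
    where open ≤-Reasoning

  ℕtoℚ-mono-≤ : ∀ {m n} → m ℕ.≤ n → ℕtoℚ m ≤ ℕtoℚ n
  ℕtoℚ-mono-≤ {m} {n} m≤n with ℕ.m≤n⇒∃[o]m+o≡n m≤n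
  ... | o , refl = ≤-by-slack (ℕtoℚ-nonNeg o) (sym (ℕtoℚ-+ m o))

  ℕtoℚ-cancel-≤ : ∀ {m n} → ℕtoℚ m ≤ ℕtoℚ n → m ℕ.≤ n
  ℕtoℚ-cancel-≤ {m} {n} p with ℕ.≤-total m n
  ... | inj₁ m≤n = m≤n
  ... | inj₂ n≤m with ℕ.m≤n⇒∃[o]m+o≡n n≤m
  ...   | zero  , eq   = ℕ.≤-reflexive (trans (sym eq) (ℕ.+-identityʳ n))
  ...   | suc o , refl = ⊥-elim (<-irrefl refl (≤-<-trans p n<n+o+1))
    where
    n<n+o+1 : ℕtoℚ n < ℕtoℚ (n ℕ.+ suc o)
    n<n+o+1 = subst (ℕtoℚ n <_) (sym (ℕtoℚ-+ n (suc o)))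
      (subst (_< ℕtoℚ n + ℕtoℚ (suc o)) (+-identityʳ (ℕtoℚ n))
        (+-monoʳ-< (ℕtoℚ n) (positive⁻¹ (ℕtoℚ (suc o)) {{normalize-pos (suc o) 1}})))

module AttenuationInequality where

  open import Data.Integer using (+_)
  open import Data.Rational
  open import Data.Rational.Properties
  open import Data.Product using (_×_; proj₁; proj₂)
  open import Data.Sum using (inj₁; inj₂)
  open import Data.Empty using (⊥-elim)
  open import Data.List using (List; _∷_; [])
  open import Relation.Binary.PropositionalEquality using (refl)
  open import Tactic.RingSolver using (solve)
  open RationalArith

  -- A halver on a segment of 2m wires holding t ones leaves x of them in the
  -- first half; the second component is the bound on the zeros left in the second half.
  HalverBound : ℚ → ℚ → ℚ → ℚ → Set
  HalverBound β m t x = (t ≤ m → x ≤ β * t) × (m ≤ t → x + m ≤ t + β * ((m + m) - t))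

  -- One step of Attenuate on |A| = |B| = 4q, counted in ones: s ones in total, a in A
  -- after the initial halver, a₁ left in A₁, b₁ moved into B₁, a₂ left in A₂ by the
  -- recursive call on (A₂, B₁) whose c = (a - a₁) + b₁ ones it sees, a₂₁ left in A₂₁,
  -- b₁₁ moved into B₁₁, and a₂₂ left in A₂₂ by the recursive call on (A₂₂, B₁₁).
  module _ (α E q s a a₁ b₁ a₂ a₂₁ b₁₁ a₂₂ : ℚ)
    (α≥0 : 0ℚ ≤ α) (α≤⅛ : α ≤ + 1 / 8) (E≥0 : 0ℚ ≤ E) (E≤⅛ : E ≤ + 1 / 8) (3α²≤E : + 3 / 1 * (α * α) ≤ E)
    (q>0 : 0ℚ < q) (a₁≥0 : 0ℚ ≤ a₁) (a-a₁≥0 : 0ℚ ≤ a - a₁) (s-a≥0 : 0ℚ ≤ s - a) (b₁≥0 : 0ℚ ≤ b₁)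
    (a₂≥0 : 0ℚ ≤ a₂) (c-a₂≥0 : 0ℚ ≤ ((a - a₁) + b₁) - a₂) (a₂₁≥0 : 0ℚ ≤ a₂₁)
    (s≤4q : s ≤ (q + q) + (q + q)) (a≤αs : a ≤ α * s)
    (A₁-bound : HalverBound α (q + q) a a₁) (B₁-bound : HalverBound α (q + q) (s - a) b₁)
    (A₂-bound : HalverBound E (q + q) ((a - a₁) + b₁) a₂)
    (A₂₁-bound : HalverBound α q a₂ a₂₁) (B₁₁-bound : HalverBound α q (((a - a₁) + b₁) - a₂) b₁₁)
    (A₂₂-bound : HalverBound E q ((a₂ - a₂₁) + b₁₁) a₂₂)
    where

    private
      vars : List ℚ
      vars = α ∷ E ∷ q ∷ s ∷ a ∷ a₁ ∷ b₁ ∷ a₂ ∷ a₂₁ ∷ b₁₁ ∷ a₂₂ ∷ []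

      ⅛-α≥0 : 0ℚ ≤ + 1 / 8 - α
      ⅛-α≥0 = slack α≤⅛

      E-3α²≥0 : 0ℚ ≤ E - + 3 / 1 * (α * α)
      E-3α²≥0 = slack 3α²≤E

      ⅛-E≥0 : 0ℚ ≤ + 1 / 8 - E
      ⅛-E≥0 = slack E≤⅛

      q≥0 : 0ℚ ≤ q
      q≥0 = <⇒≤ q>0

      4q-s≥0 : 0ℚ ≤ ((q + q) + (q + q)) - s
      4q-s≥0 = slack s≤4q

      a≥0 : 0ℚ ≤ a
      a≥0 = ≤-by-slack (a₁≥0 ⊕ a-a₁≥0) (solve vars ℚ-ring)

      s≥0 : 0ℚ ≤ s
      s≥0 = ≤-by-slack (a≥0 ⊕ s-a≥0) (solve vars ℚ-ring)

      c≥0 : 0ℚ ≤ ((a - a₁) + b₁)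
      c≥0 = a-a₁≥0 ⊕ b₁≥0

      a≤2q : a ≤ (q + q)
      a≤2q = ≤-by-slack (slack a≤αs ⊕ s≥0 ⊗ ⅛-α≥0 ⊕ n/d-nonNeg 1 8 ⊗ 4q-s≥0 ⊕ n/d-nonNeg 3 2 ⊗ q≥0)
        (solve vars ℚ-ring)

      a₁≤αa : a₁ ≤ α * a
      a₁≤αa = proj₁ A₁-bound a≤2q

      a₁≤α²s : a₁ ≤ (α * α) * s
      a₁≤α²s = ≤-by-slack (slack a₁≤αa ⊕ α≥0 ⊗ slack a≤αs) (solve vars ℚ-ring)

      remainder≤Es : (q + q) ≤ s → ((α * α) * s + (α * (α * α)) * s) + ((α * E) * (q + q) + E * q) ≤ E * s
      remainder≤Es 2q≤s = ≤-by-slack (slack 2q≤s ⊗ E-3α²≥0 ⊕ n/d-nonNeg 15 8 ⊗ slack 2q≤s ⊗ α≥0 ⊗ α≥0 ⊕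
          slack 2q≤s ⊗ (α≥0 ⊗ α≥0) ⊗ ⅛-α≥0 ⊕ q≥0 ⊗ E-3α²≥0 ⊗ (n/d-nonNeg 2 1 ⊗ ⅛-α≥0 ⊕ n/d-nonNeg 3 4) ⊕
          n/d-nonNeg 8 1 ⊗ q≥0 ⊗ (α≥0 ⊗ α≥0) ⊗ ⅛-α≥0)
        (solve vars ℚ-ring)

      b₁≤α[s-a]⇒c≤2αs : b₁ ≤ α * (s - a) → ((a - a₁) + b₁) ≤ ((+ 2 / 1) * α) * s
      b₁≤α[s-a]⇒c≤2αs b₁≤α[s-a] = ≤-by-slack (slack a≤αs ⊕ a₁≥0 ⊕ slack b₁≤α[s-a] ⊕ α≥0 ⊗ a≥0)
        (solve vars ℚ-ring)

      2αs≤q : ((+ 2 / 1) * α) * s ≤ q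
      2αs≤q = ≤-by-slack (n/d-nonNeg 2 1 ⊗ α≥0 ⊗ 4q-s≥0 ⊕ n/d-nonNeg 8 1 ⊗ q≥0 ⊗ ⅛-α≥0) (solve vars ℚ-ring)

      module FewOnes (s≤2q : s ≤ (q + q)) where
        s-a≤2q : (s - a) ≤ (q + q)
        s-a≤2q = ≤-by-slack (slack s≤2q ⊕ a≥0) (solve vars ℚ-ring)

        b₁≤α[s-a] : b₁ ≤ α * (s - a)
        b₁≤α[s-a] = proj₁ B₁-bound s-a≤2q

        c≤2αs : ((a - a₁) + b₁) ≤ ((+ 2 / 1) * α) * s
        c≤2αs = b₁≤α[s-a]⇒c≤2αs b₁≤α[s-a]

        c≤q : ((a - a₁) + b₁) ≤ q
        c≤q = ≤-by-slack (slack c≤2αs ⊕ (n/d-nonNeg 2 1 ⊗ α≥0) ⊗ slack s≤2q ⊕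
            q≥0 ⊗ (n/d-nonNeg 4 1 ⊗ ⅛-α≥0 ⊕ n/d-nonNeg 1 2))
          (solve vars ℚ-ring)

        c≤2q : ((a - a₁) + b₁) ≤ (q + q)
        c≤2q = ≤-by-slack (slack c≤q ⊕ q≥0) (solve vars ℚ-ring)

        a₂≤Ec : a₂ ≤ E * ((a - a₁) + b₁)
        a₂≤Ec = proj₁ A₂-bound c≤2q

        a₂≤q : a₂ ≤ q
        a₂≤q = ≤-by-slack (slack a₂≤Ec ⊕ c≥0 ⊗ (⅛-E≥0 ⊕ n/d-nonNeg 7 8) ⊕ slack c≤q) (solve vars ℚ-ring)

        a₂₁≤αa₂ : a₂₁ ≤ α * a₂
        a₂₁≤αa₂ = proj₁ A₂₁-bound a₂≤q

        c-a₂≤q : (((a - a₁) + b₁) - a₂) ≤ q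
        c-a₂≤q = ≤-by-slack (slack c≤q ⊕ a₂≥0) (solve vars ℚ-ring)

        b₁₁≤α[c-a₂] : b₁₁ ≤ α * (((a - a₁) + b₁) - a₂)
        b₁₁≤α[c-a₂] = proj₁ B₁₁-bound c-a₂≤q

        c′≤c : ((a₂ - a₂₁) + b₁₁) ≤ ((a - a₁) + b₁)
        c′≤c = ≤-by-slack (slack b₁₁≤α[c-a₂] ⊕ c-a₂≥0 ⊗ (⅛-α≥0 ⊕ n/d-nonNeg 7 8) ⊕ a₂₁≥0) (solve vars ℚ-ring)

        c′≤q : ((a₂ - a₂₁) + b₁₁) ≤ q
        c′≤q = ≤-by-slack (slack c′≤c ⊕ slack c≤q) (solve vars ℚ-ring)

        a₂₂≤Ec′ : a₂₂ ≤ E * ((a₂ - a₂₁) + b₁₁)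
        a₂₂≤Ec′ = proj₁ A₂₂-bound c′≤q

        c≤s/4 : ((a - a₁) + b₁) ≤ (+ 1 / 4) * s
        c≤s/4 = ≤-by-slack (slack c≤2αs ⊕ n/d-nonNeg 2 1 ⊗ s≥0 ⊗ ⅛-α≥0) (solve vars ℚ-ring)

        bound : (a₁ + a₂₁) + a₂₂ ≤ E * s
        bound = ≤-by-slack (slack a₁≤α²s ⊕ slack a₂₁≤αa₂ ⊕ α≥0 ⊗ slack a₂≤Ec ⊕ slack a₂₂≤Ec′ ⊕ E≥0 ⊗ slack c′≤c ⊕
            (E≥0 ⊗ (n/d-nonNeg 1 1 ⊕ α≥0)) ⊗ slack c≤s/4 ⊕
            s≥0 ⊗ E-3α²≥0 ⊗ (n/d-nonNeg 1 4 ⊗ ⅛-α≥0 ⊕ n/d-nonNeg 23 32) ⊕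
            s≥0 ⊗ (α≥0 ⊗ α≥0) ⊗ (n/d-nonNeg 3 4 ⊗ ⅛-α≥0 ⊕ n/d-nonNeg 37 32))
          (solve vars ℚ-ring)

      module FewOnesInA₂B₁ (2q≤s : (q + q) ≤ s) (c≤2q : ((a - a₁) + b₁) ≤ (q + q)) where
        a₂≤Ec : a₂ ≤ E * ((a - a₁) + b₁)
        a₂≤Ec = proj₁ A₂-bound c≤2q

        a₂≤2Eq : a₂ ≤ E * (q + q)
        a₂≤2Eq = ≤-by-slack (slack a₂≤Ec ⊕ E≥0 ⊗ slack c≤2q) (solve vars ℚ-ring)

        a₂≤q : a₂ ≤ q
        a₂≤q = ≤-by-slack (slack a₂≤2Eq ⊕ q≥0 ⊗ (n/d-nonNeg 2 1 ⊗ ⅛-E≥0 ⊕ n/d-nonNeg 3 4)) (solve vars ℚ-ring)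

        a₂₁≤αa₂ : a₂₁ ≤ α * a₂
        a₂₁≤αa₂ = proj₁ A₂₁-bound a₂≤q

        c′≤q⇒bound : ((a₂ - a₂₁) + b₁₁) ≤ q → a₂₁ + a₂₂ ≤ α * a₂ + E * q
        c′≤q⇒bound c′≤q = ≤-by-slack (slack a₂₁≤αa₂ ⊕ slack (proj₁ A₂₂-bound c′≤q) ⊕ E≥0 ⊗ slack c′≤q)
          (solve vars ℚ-ring)

        c-a₂≤q⇒c′≤q : (((a - a₁) + b₁) - a₂) ≤ q → ((a₂ - a₂₁) + b₁₁) ≤ q
        c-a₂≤q⇒c′≤q c-a₂≤q = ≤-by-slack (slack (proj₁ B₁₁-bound c-a₂≤q) ⊕ a₂₁≥0 ⊕ slack a₂≤2Eq ⊕
            q≥0 ⊗ (n/d-nonNeg 2 1 ⊗ ⅛-E≥0 ⊕ ⅛-α≥0 ⊕ n/d-nonNeg 5 8) ⊕ α≥0 ⊗ slack c-a₂≤q)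
          (solve vars ℚ-ring)

        q≤c-a₂⇒q≤c′⇒bound : q ≤ (((a - a₁) + b₁) - a₂) → q ≤ ((a₂ - a₂₁) + b₁₁) → a₂₁ + a₂₂ ≤ α * a₂ + E * q
        q≤c-a₂⇒q≤c′⇒bound q≤c-a₂ q≤c′ = ≤-by-slack (slack (proj₂ A₂₂-bound q≤c′) ⊕
            (n/d-nonNeg 7 8 ⊕ ⅛-E≥0) ⊗ slack (proj₂ B₁₁-bound q≤c-a₂) ⊕
            ((n/d-nonNeg 7 8 ⊕ ⅛-E≥0) ⊗ (n/d-nonNeg 7 8 ⊕ ⅛-α≥0)) ⊗ slack c≤2q ⊕ E≥0 ⊗ slack a₂₁≤αa₂)
          (solve vars ℚ-ring)

        a₂₁+a₂₂-bound : a₂₁ + a₂₂ ≤ α * a₂ + E * q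
        a₂₁+a₂₂-bound with ≤-total ((a₂ - a₂₁) + b₁₁) q | ≤-total (((a - a₁) + b₁) - a₂) q
        ... | inj₁ c′≤q | _          = c′≤q⇒bound c′≤q
        ... | inj₂ _    | inj₁ c-a₂≤q = c′≤q⇒bound (c-a₂≤q⇒c′≤q c-a₂≤q)
        ... | inj₂ q≤c′ | inj₂ q≤c-a₂ = q≤c-a₂⇒q≤c′⇒bound q≤c-a₂ q≤c′

        bound : (a₁ + a₂₁) + a₂₂ ≤ E * s
        bound = ≤-by-slack (slack a₁≤α²s ⊕ slack a₂₁+a₂₂-bound ⊕ α≥0 ⊗ slack a₂≤2Eq ⊕ (α≥0 ⊗ α≥0 ⊗ α≥0) ⊗ s≥0 ⊕
            slack (remainder≤Es 2q≤s))
          (solve vars ℚ-ring)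

      module ManyOnesInB (2q≤s : (q + q) ≤ s) (2q≤c : (q + q) ≤ ((a - a₁) + b₁)) (2q≤s-a : (q + q) ≤ (s - a)) where
        B₁-bound-large : b₁ + (q + q) ≤ (s - a) + α * (((q + q) + (q + q)) - (s - a))
        B₁-bound-large = proj₂ B₁-bound 2q≤s-a

        a₁+c-2q≤αa : a₁ + (((a - a₁) + b₁) - (q + q)) ≤ α * a
        a₁+c-2q≤αa = ≤-by-slack (slack B₁-bound-large ⊕ (n/d-nonNeg 7 8 ⊕ ⅛-α≥0) ⊗ 4q-s≥0) (solve vars ℚ-ring)

        A₂-bound-large : a₂ + (q + q) ≤ ((a - a₁) + b₁) + E * (((q + q) + (q + q)) - ((a - a₁) + b₁))
        A₂-bound-large = proj₂ A₂-bound 2q≤c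

        a₂≤c-2q+2Eq : a₂ ≤ (((a - a₁) + b₁) - (q + q)) + E * (q + q)
        a₂≤c-2q+2Eq = ≤-by-slack (slack A₂-bound-large ⊕ E≥0 ⊗ slack 2q≤c) (solve vars ℚ-ring)

        a₂≤q : a₂ ≤ q
        a₂≤q = ≤-by-slack (slack a₂≤c-2q+2Eq ⊕ slack a₁+c-2q≤αa ⊕ a₁≥0 ⊕ α≥0 ⊗ slack a≤αs ⊕ (α≥0 ⊗ α≥0) ⊗ 4q-s≥0 ⊕
            q≥0 ⊗ (n/d-nonNeg 2 1 ⊗ ⅛-E≥0 ⊕ n/d-nonNeg 4 1 ⊗ α≥0 ⊗ ⅛-α≥0 ⊕ n/d-nonNeg 1 2 ⊗ ⅛-α≥0 ⊕ n/d-nonNeg 11 16))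
          (solve vars ℚ-ring)

        a₂₁≤αa₂ : a₂₁ ≤ α * a₂
        a₂₁≤αa₂ = proj₁ A₂₁-bound a₂≤q

        c′≤q⇒bound : ((a₂ - a₂₁) + b₁₁) ≤ q → a₂₁ + a₂₂ ≤ (α * a₂ + (((a - a₁) + b₁) - (q + q))) + E * q
        c′≤q⇒bound c′≤q = ≤-by-slack (slack a₂₁≤αa₂ ⊕ slack (proj₁ A₂₂-bound c′≤q) ⊕ E≥0 ⊗ slack c′≤q ⊕
            slack 2q≤c)
          (solve vars ℚ-ring)

        c-a₂≤q⇒c′≤q : (((a - a₁) + b₁) - a₂) ≤ q → ((a₂ - a₂₁) + b₁₁) ≤ q
        c-a₂≤q⇒c′≤q c-a₂≤q = ≤-by-slack (slack (proj₁ B₁₁-bound c-a₂≤q) ⊕ a₂₁≥0 ⊕ α≥0 ⊗ slack c-a₂≤q ⊕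
            slack a₂≤c-2q+2Eq ⊕ slack a₁+c-2q≤αa ⊕ a₁≥0 ⊕ α≥0 ⊗ slack a≤αs ⊕ (α≥0 ⊗ α≥0) ⊗ 4q-s≥0 ⊕
            q≥0 ⊗ (n/d-nonNeg 2 1 ⊗ ⅛-E≥0 ⊕ n/d-nonNeg 4 1 ⊗ α≥0 ⊗ ⅛-α≥0 ⊕ n/d-nonNeg 3 2 ⊗ ⅛-α≥0 ⊕ n/d-nonNeg 9 16))
          (solve vars ℚ-ring)

        q≤c-a₂⇒q≤c′⇒bound : q ≤ (((a - a₁) + b₁) - a₂) → q ≤ ((a₂ - a₂₁) + b₁₁) → a₂₁ + a₂₂ ≤ (α * a₂ + (((a - a₁) + b₁) - (q + q))) + E * q
        q≤c-a₂⇒q≤c′⇒bound q≤c-a₂ q≤c′ = ≤-by-slack (slack (proj₂ A₂₂-bound q≤c′) ⊕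
            (n/d-nonNeg 7 8 ⊕ ⅛-E≥0) ⊗ slack (proj₂ B₁₁-bound q≤c-a₂) ⊕ E≥0 ⊗ slack a₂₁≤αa₂ ⊕
            slack 2q≤c ⊗ (E≥0 ⊕ α≥0 ⊗ (n/d-nonNeg 7 8 ⊕ ⅛-E≥0)))
          (solve vars ℚ-ring)

        a₂₁+a₂₂-bound : a₂₁ + a₂₂ ≤ (α * a₂ + (((a - a₁) + b₁) - (q + q))) + E * q
        a₂₁+a₂₂-bound with ≤-total ((a₂ - a₂₁) + b₁₁) q | ≤-total (((a - a₁) + b₁) - a₂) q
        ... | inj₁ c′≤q | _          = c′≤q⇒bound c′≤q
        ... | inj₂ _    | inj₁ c-a₂≤q = c′≤q⇒bound (c-a₂≤q⇒c′≤q c-a₂≤q)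
        ... | inj₂ q≤c′ | inj₂ q≤c-a₂ = q≤c-a₂⇒q≤c′⇒bound q≤c-a₂ q≤c′

        bound : (a₁ + a₂₁) + a₂₂ ≤ E * s
        bound = ≤-by-slack (slack a₂₁+a₂₂-bound ⊕ α≥0 ⊗ slack a₂≤c-2q+2Eq ⊕
            (n/d-nonNeg 1 1 ⊕ α≥0) ⊗ slack a₁+c-2q≤αa ⊕ α≥0 ⊗ a₁≥0 ⊕ (α≥0 ⊕ α≥0 ⊗ α≥0) ⊗ slack a≤αs ⊕
            slack (remainder≤Es 2q≤s))
          (solve vars ℚ-ring)

      2q≤c⇒s-a≤2q⇒q≤0 : (q + q) ≤ ((a - a₁) + b₁) → (s - a) ≤ (q + q) → q ≤ 0ℚ
      2q≤c⇒s-a≤2q⇒q≤0 2q≤c s-a≤2q = ≤-by-slack (slack (b₁≤α[s-a]⇒c≤2αs (proj₁ B₁-bound s-a≤2q)) ⊕ slack 2αs≤q ⊕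
          slack 2q≤c)
        (solve vars ℚ-ring)

    attenuation-inequality : (a₁ + a₂₁) + a₂₂ ≤ E * s
    attenuation-inequality with ≤-total s (q + q)
    ... | inj₁ s≤2q = FewOnes.bound s≤2q
    ... | inj₂ 2q≤s with ≤-total ((a - a₁) + b₁) (q + q)
    ...   | inj₁ c≤2q = FewOnesInA₂B₁.bound 2q≤s c≤2q
    ...   | inj₂ 2q≤c with ≤-total (s - a) (q + q)
    ...     | inj₁ s-a≤2q = ⊥-elim (<-irrefl refl (<-≤-trans q>0 (2q≤c⇒s-a≤2q⇒q≤0 2q≤c s-a≤2q)))
    ...     | inj₂ 2q≤s-a = ManyOnesInB.bound 2q≤s 2q≤c 2q≤s-a

module Networks where

  open import Data.Nat using (ℕ; zero; suc; _+_; _≤_; _<_; _≡ᵇ_)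
  open import Data.Nat.Properties
  open import Data.Product using (_×_; _,_; proj₁; proj₂)
  open import Data.List using (List; []; _∷_; _++_)
  open import Data.List.Properties using (map-++)
  open import Data.List.Relation.Unary.All using (All; []; _∷_)
  open import Data.Fin using (Fin)
  open import Data.Fin.Properties using (toℕ<n)
  open import Relation.Binary.PropositionalEquality
  open import Defs
  open BoolComparisons using (≢⇒≡ᵇ-false)

  run-++ : ∀ xs ys f → run (xs ++ ys) f ≡ run ys (run xs f)
  run-++ []       ys f = refl
  run-++ (c ∷ xs) ys f = run-++ xs ys (cex c f)

  cex-cong : ∀ c {f g} → (∀ k → f k ≡ g k) → ∀ i → cex c f i ≡ cex c g i
  cex-cong (p , q) f≗g i rewrite f≗g p | f≗g q | f≗g i = refl

  run-cong : ∀ N {f g} → (∀ k → f k ≡ g k) → ∀ i → run N f i ≡ run N g i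
  run-cong []      f≗g = f≗g
  run-cong (c ∷ N) f≗g = run-cong N (cex-cong c f≗g)

  cex-other : ∀ p q f j → j ≢ p → j ≢ q → cex (p , q) f j ≡ f j
  cex-other p q f j j≢p j≢q rewrite ≢⇒≡ᵇ-false j≢p | ≢⇒≡ᵇ-false j≢q = refl

  OnWires : ℕ → Network → Set
  OnWires L = All (λ c → proj₁ c < L × proj₂ c < L)

  OnWires-++ : ∀ {L} xs ys → OnWires L xs → OnWires L ys → OnWires L (xs ++ ys)
  OnWires-++ []       ys _         ys-on = ys-on
  OnWires-++ (x ∷ xs) ys (x-on ∷ xs-on) ys-on = x-on ∷ OnWires-++ xs ys xs-on ys-on

  OnWires-mono : ∀ {L L′} N → L ≤ L′ → OnWires L N → OnWires L′ N
  OnWires-mono []      _    _ = []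
  OnWires-mono (_ ∷ N) L≤L′ ((p<L , q<L) ∷ N-on) =
    (<-≤-trans p<L L≤L′ , <-≤-trans q<L L≤L′) ∷ OnWires-mono N L≤L′ N-on

  OnWires-shift : ∀ {L} o N → OnWires L N → OnWires (o + L) (shift o N)
  OnWires-shift o []      _ = []
  OnWires-shift o (_ ∷ N) ((p<L , q<L) ∷ N-on) = (+-monoʳ-< o p<L , +-monoʳ-< o q<L) ∷ OnWires-shift o N N-on

  OnWires-toNet : ∀ {m} (xs : List (Fin m × Fin m)) → OnWires m (toNet xs)
  OnWires-toNet []             = []
  OnWires-toNet ((p , q) ∷ xs) = (toℕ<n p , toℕ<n q) ∷ OnWires-toNet xs

  run-outside : ∀ {L} N → OnWires L N → ∀ f j → L ≤ j → run N f j ≡ f j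
  run-outside []            _                    f j _   = refl
  run-outside ((p , q) ∷ N) ((p<L , q<L) ∷ N-on) f j L≤j =
    trans (run-outside N N-on (cex (p , q) f) j L≤j)
          (cex-other p q f j (λ j≡p → <-irrefl (sym j≡p) (<-≤-trans p<L L≤j))
                             (λ j≡q → <-irrefl (sym j≡q) (<-≤-trans q<L L≤j)))

  shift-++ : ∀ o xs ys → shift o (xs ++ ys) ≡ shift o xs ++ shift o ys
  shift-++ o = map-++ _

  private
    +-≡ᵇ-cancelˡ : ∀ o k p → (o + k ≡ᵇ o + p) ≡ (k ≡ᵇ p)
    +-≡ᵇ-cancelˡ zero    k p = refl
    +-≡ᵇ-cancelˡ (suc o) k p = +-≡ᵇ-cancelˡ o k p

    cex-shift : ∀ o p q f k → cex (o + p , o + q) f (o + k) ≡ cex (p , q) (λ j → f (o + j)) k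
    cex-shift o p q f k rewrite +-≡ᵇ-cancelˡ o k p | +-≡ᵇ-cancelˡ o k q = refl

  run-shift : ∀ o N f i → run (shift o N) f (o + i) ≡ run N (λ j → f (o + j)) i
  run-shift o []            f i = refl
  run-shift o ((p , q) ∷ N) f i =
    trans (run-shift o N (cex (o + p , o + q) f) i) (run-cong N (cex-shift o p q f) i)

  run-shift-below : ∀ o N f j → j < o → run (shift o N) f j ≡ f j
  run-shift-below o []            f j _   = refl
  run-shift-below o ((p , q) ∷ N) f j j<o =
    trans (run-shift-below o N (cex (o + p , o + q) f) j j<o)
          (cex-other (o + p) (o + q) f j (λ j≡o+p → <-irrefl j≡o+p (<-≤-trans j<o (m≤m+n o p)))
                                         (λ j≡o+q → <-irrefl j≡o+q (<-≤-trans j<o (m≤m+n o q))))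

module Counting where

  open import Data.Nat using (ℕ; zero; suc; _+_; _∸_; _≤_; _<_; z≤n; s≤s; s≤s⁻¹; _≡ᵇ_)
  open import Data.Nat.Properties
  open import Data.Bool using (Bool; true; false; not; if_then_else_)
  open import Data.Product using (_×_; _,_; Σ-syntax)
  open import Data.Sum using (inj₁; inj₂)
  open import Relation.Nullary using (yes; no)
  open import Relation.Binary.PropositionalEquality
  open import Defs using (count)
  open BoolComparisons using (≡ᵇ-refl; ≢⇒≡ᵇ-false)

  ⟨_⟩ : Bool → ℕ
  ⟨ b ⟩ = if b then 1 else 0

  count-ext : ∀ {P Q} m → (∀ j → j < m → P j ≡ Q j) → count P m ≡ count Q m
  count-ext zero    _   = refl
  count-ext (suc m) P≗Q =
    cong₂ (λ x b → x + ⟨ b ⟩) (count-ext m (λ j j<m → P≗Q j (m<n⇒m<1+n j<m))) (P≗Q m (n<1+n m))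

  count-≤ : ∀ P m → count P m ≤ m
  count-≤ P zero    = z≤n
  count-≤ P (suc m) with P m
  ... | true  = subst (_≤ suc m) (+-comm 1 (count P m)) (s≤s (count-≤ P m))
  ... | false = subst (_≤ suc m) (sym (+-identityʳ (count P m))) (m≤n⇒m≤1+n (count-≤ P m))

  count-split : ∀ P a b → count P (a + b) ≡ count P a + count (λ j → P (a + j)) b
  count-split P a zero    rewrite +-identityʳ a = sym (+-identityʳ (count P a))
  count-split P a (suc b) rewrite +-suc a b | count-split P a b =
    +-assoc (count P a) (count (λ j → P (a + j)) b) _

  count-split-≤ : ∀ P a b → count P (a + b) ≤ count P a + b
  count-split-≤ P a b = subst (_≤ count P a + b) (sym (count-split P a b)) (+-monoʳ-≤ (count P a) (count-≤ _ b))

  count-mono : ∀ {P Q} m → (∀ j → j < m → P j ≡ true → Q j ≡ true) → count P m ≤ count Q m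
  count-mono zero    _   = z≤n
  count-mono {P} {Q} (suc m) P⊆Q with P m in Pm | Q m in Qm
  ... | false | _     = +-mono-≤ (count-mono m (λ j j<m → P⊆Q j (m<n⇒m<1+n j<m))) z≤n
  ... | true  | true  = +-mono-≤ (count-mono m (λ j j<m → P⊆Q j (m<n⇒m<1+n j<m))) ≤-refl
  ... | true  | false with trans (sym (P⊆Q m (n<1+n m) Pm)) Qm
  ...   | ()

  count-none : ∀ P m → (∀ j → j < m → P j ≡ false) → count P m ≡ 0
  count-none P zero    _    = refl
  count-none P (suc m) none rewrite none m (n<1+n m) =
    trans (+-identityʳ _) (count-none P m (λ j j<m → none j (m<n⇒m<1+n j<m)))

  count-all : ∀ P m → (∀ j → j < m → P j ≡ true) → count P m ≡ m
  count-all P zero    _   = refl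
  count-all P (suc m) all rewrite all m (n<1+n m) | count-all P m (λ j j<m → all j (m<n⇒m<1+n j<m)) =
    +-comm m 1

  count-pos : ∀ P m → 0 < count P m → Σ[ j ∈ ℕ ] j < m × P j ≡ true
  count-pos P (suc m) pos with P m in Pm
  ... | true  = m , n<1+n m , Pm
  ... | false with count-pos P m (subst (0 <_) (+-identityʳ _) pos)
  ...   | j , j<m , Pj = j , m<n⇒m<1+n j<m , Pj

  count-suffix : ∀ P L c → c ≤ L → (∀ j → j < L → c ≤ j → P j ≡ true) → L ∸ c ≤ count P L
  count-suffix P zero    c _   _   rewrite 0∸n≡0 c = z≤n
  count-suffix P (suc L) c c≤1+L all with m≤n⇒m<n∨m≡n c≤1+L
  ... | inj₂ refl = subst (_≤ count P (suc L)) (sym (n∸n≡0 (suc L))) z≤n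
  ... | inj₁ c<1+L rewrite all L (n<1+n L) (s≤s⁻¹ c<1+L) | +-∸-assoc 1 (s≤s⁻¹ c<1+L) =
    subst (suc (L ∸ c) ≤_) (+-comm 1 (count P L))
      (s≤s (count-suffix P L c (s≤s⁻¹ c<1+L) (λ j j<L c≤j → all j (m<n⇒m<1+n j<L) c≤j)))

  count-not : ∀ P m → count P m + count (λ j → not (P j)) m ≡ m
  count-not P zero    = refl
  count-not P (suc m) with P m
  ... | true  rewrite +-identityʳ (count (λ j → not (P j)) m) | +-comm (count P m) 1 =
    cong suc (count-not P m)
  ... | false rewrite +-identityʳ (count P m)
                    | sym (+-assoc (count P m) (count (λ j → not (P j)) m) 1) | count-not P m = +-comm m 1

  count-update : ∀ {P Q} m p → p < m → (∀ j → j ≢ p → P j ≡ Q j) →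
                 count P m + ⟨ Q p ⟩ ≡ count Q m + ⟨ P p ⟩
  count-update {P} {Q} (suc m) p p<1+m P≗Q with m≤n⇒m<n∨m≡n (s≤s⁻¹ p<1+m)
  ... | inj₂ refl rewrite count-ext {P} {Q} m (λ j j<m → P≗Q j (λ j≡m → <-irrefl j≡m j<m)) =
    swap-last (count Q m) ⟨ P m ⟩ ⟨ Q m ⟩
    where
    swap-last : ∀ x y z → x + y + z ≡ x + z + y
    swap-last x y z = trans (+-assoc x y z) (trans (cong (x +_) (+-comm y z)) (sym (+-assoc x z y)))
  ... | inj₁ p<m rewrite P≗Q m (λ m≡p → <-irrefl (sym m≡p) p<m) = begin
    count P m + ⟨ Q m ⟩ + ⟨ Q p ⟩   ≡⟨ +-assoc (count P m) _ _ ⟩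
    count P m + (⟨ Q m ⟩ + ⟨ Q p ⟩) ≡⟨ cong (count P m +_) (+-comm ⟨ Q m ⟩ _) ⟩
    count P m + (⟨ Q p ⟩ + ⟨ Q m ⟩) ≡⟨ sym (+-assoc (count P m) _ _) ⟩
    count P m + ⟨ Q p ⟩ + ⟨ Q m ⟩   ≡⟨ cong (_+ ⟨ Q m ⟩) (count-update m p p<m P≗Q) ⟩
    count Q m + ⟨ P p ⟩ + ⟨ Q m ⟩   ≡⟨ +-assoc (count Q m) _ _ ⟩
    count Q m + (⟨ P p ⟩ + ⟨ Q m ⟩) ≡⟨ cong (count Q m +_) (+-comm ⟨ P p ⟩ _) ⟩
    count Q m + (⟨ Q m ⟩ + ⟨ P p ⟩) ≡⟨ sym (+-assoc (count Q m) _ _) ⟩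
    count Q m + ⟨ Q m ⟩ + ⟨ P p ⟩   ∎
    where open ≡-Reasoning

  count-update₂ : ∀ {P Q} m p q → p < m → q < m → p ≢ q → (∀ j → j ≢ p → j ≢ q → P j ≡ Q j) →
                  ⟨ P p ⟩ + ⟨ P q ⟩ ≡ ⟨ Q p ⟩ + ⟨ Q q ⟩ → count P m ≡ count Q m
  count-update₂ {P} {Q} m p q p<m q<m p≢q P≗Q sum≡ =
    +-cancelʳ-≡ (⟨ Q p ⟩ + ⟨ Q q ⟩) _ _ (begin
      count P m + (⟨ Q p ⟩ + ⟨ Q q ⟩)  ≡⟨ sym (+-assoc (count P m) _ _) ⟩
      count P m + ⟨ Q p ⟩ + ⟨ Q q ⟩    ≡⟨ cong (λ b → count P m + ⟨ b ⟩ + ⟨ Q q ⟩) (sym R-p) ⟩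
      count P m + ⟨ R p ⟩ + ⟨ Q q ⟩    ≡⟨ cong (_+ ⟨ Q q ⟩) P-to-R ⟩
      count R m + ⟨ P p ⟩ + ⟨ Q q ⟩    ≡⟨ +-assoc (count R m) _ _ ⟩
      count R m + (⟨ P p ⟩ + ⟨ Q q ⟩)  ≡⟨ cong (count R m +_) (+-comm ⟨ P p ⟩ _) ⟩
      count R m + (⟨ Q q ⟩ + ⟨ P p ⟩)  ≡⟨ sym (+-assoc (count R m) _ _) ⟩
      count R m + ⟨ Q q ⟩ + ⟨ P p ⟩    ≡⟨ cong (_+ ⟨ P p ⟩) R-to-Q ⟩
      count Q m + ⟨ R q ⟩ + ⟨ P p ⟩    ≡⟨ cong (λ b → count Q m + ⟨ b ⟩ + ⟨ P p ⟩) (R-at q (≢-sym p≢q)) ⟩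
      count Q m + ⟨ P q ⟩ + ⟨ P p ⟩    ≡⟨ +-assoc (count Q m) _ _ ⟩
      count Q m + (⟨ P q ⟩ + ⟨ P p ⟩)  ≡⟨ cong (count Q m +_) (trans (+-comm ⟨ P q ⟩ _) sum≡) ⟩
      count Q m + (⟨ Q p ⟩ + ⟨ Q q ⟩)  ∎)
    where
    open ≡-Reasoning
    R : ℕ → Bool
    R j = if j ≡ᵇ p then Q p else P j
    R-p : R p ≡ Q p
    R-p = cong (λ b → if b then Q p else P p) (≡ᵇ-refl p)
    R-at : ∀ j → j ≢ p → R j ≡ P j
    R-at j j≢p = cong (λ b → if b then Q p else P j) (≢⇒≡ᵇ-false j≢p)
    P-to-R : count P m + ⟨ R p ⟩ ≡ count R m + ⟨ P p ⟩
    P-to-R = count-update m p p<m (λ j j≢p → sym (R-at j j≢p))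
    R-to-Q : count R m + ⟨ Q q ⟩ ≡ count Q m + ⟨ R q ⟩
    R-to-Q = count-update m q q<m R≗Q
      where
      R≗Q : ∀ j → j ≢ q → R j ≡ Q j
      R≗Q j j≢q with j ≟ p
      ... | yes refl = R-p
      ... | no j≢p   = trans (R-at j j≢p) (P≗Q j j≢p j≢q)

  private
    insert : ℕ → (ℕ → Bool) → ℕ → Bool
    insert p B j = if j ≡ᵇ p then true else B j

    insert-other : ∀ p B j → j ≢ p → insert p B j ≡ B j
    insert-other p B j j≢p = cong (λ b → if b then true else B j) (≢⇒≡ᵇ-false j≢p)

    insert-at : ∀ p B → insert p B p ≡ true
    insert-at p B = cong (λ b → if b then true else B p) (≡ᵇ-refl p)

    count-insert : ∀ B L p → p < L → count (insert p B) L + ⟨ B p ⟩ ≡ suc (count B L)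
    count-insert B L p p<L = begin
      count (insert p B) L + ⟨ B p ⟩           ≡⟨ count-update L p p<L (insert-other p B) ⟩
      count B L + ⟨ insert p B p ⟩             ≡⟨ cong (λ b → count B L + ⟨ b ⟩) (insert-at p B) ⟩
      count B L + 1                            ≡⟨ +-comm (count B L) 1 ⟩
      suc (count B L)                          ∎
      where open ≡-Reasoning

  count-mono-except : ∀ {A B} L p → p < L → (∀ j → j < L → j ≢ p → A j ≡ true → B j ≡ true) →
                      count A L ≤ suc (count B L)
  count-mono-except {A} {B} L p p<L A⊆B = begin
    count A L                            ≤⟨ count-mono L A⊆B∪p ⟩
    count (insert p B) L                 ≤⟨ m≤m+n _ ⟨ B p ⟩ ⟩
    count (insert p B) L + ⟨ B p ⟩       ≡⟨ count-insert B L p p<L ⟩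
    suc (count B L)                      ∎
    where
    open ≤-Reasoning
    A⊆B∪p : ∀ j → j < L → A j ≡ true → insert p B j ≡ true
    A⊆B∪p j j<L Aj with j ≟ p
    ... | yes refl = insert-at p B
    ... | no j≢p   = trans (insert-other p B j j≢p) (A⊆B j j<L j≢p Aj)

  count-mono-strict : ∀ {A B} L p → p < L → (∀ j → j < L → A j ≡ true → B j ≡ true) →
                      A p ≡ false → B p ≡ true → suc (count A L) ≤ count B L
  count-mono-strict {A} {B} L p p<L A⊆B Ap Bp = begin
    suc (count A L)                      ≡⟨ sym (count-insert A L p p<L) ⟩
    count (insert p A) L + ⟨ A p ⟩       ≡⟨ cong (λ b → count (insert p A) L + ⟨ b ⟩) Ap ⟩
    count (insert p A) L + 0             ≡⟨ +-identityʳ _ ⟩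
    count (insert p A) L                 ≤⟨ count-mono L A∪p⊆B ⟩
    count B L                            ∎
    where
    open ≤-Reasoning
    A∪p⊆B : ∀ j → j < L → insert p A j ≡ true → B j ≡ true
    A∪p⊆B j j<L Aj with j ≟ p
    ... | yes refl = Bp
    ... | no j≢p   = A⊆B j j<L (trans (sym (insert-other p A j j≢p)) Aj)

module ZeroOne where

  open import Data.Nat using (ℕ; _+_; _≤_; _<_; _⊓_; _⊔_; _≡ᵇ_)
  open import Data.Nat.Properties
  open import Data.Bool using (Bool; true; false; not; _∧_; _∨_; T)
  open import Data.Bool.Properties using (∧-comm; ∨-comm)
  open import Data.Unit using (tt)
  open import Data.List using ([]; _∷_)
  open import Data.List.Relation.Unary.All using ([]; _∷_)
  open import Data.Product using (_,_)
  open import Data.Sum using (inj₁; inj₂)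
  open import Relation.Nullary using (yes; no)
  open import Relation.Binary.PropositionalEquality
  open import Defs
  open BoolComparisons using (≡ᵇ-refl; ≢⇒≡ᵇ-false)
  open Networks
  open Counting

  Monotone : (ℕ → Bool) → Set
  Monotone P = ∀ {v w} → v ≤ w → P v ≡ true → P w ≡ true

  module _ {P : ℕ → Bool} (mono : Monotone P) where

    private
      ≤⇒≡∧ : ∀ {x y} → x ≤ y → P x ≡ P x ∧ P y
      ≤⇒≡∧ {x} x≤y with P x in Px
      ... | false = refl
      ... | true  = sym (mono x≤y Px)

      ≤⇒≡∨ : ∀ {x y} → x ≤ y → P y ≡ P x ∨ P y
      ≤⇒≡∨ {x} x≤y with P x in Px
      ... | false = refl
      ... | true  = mono x≤y Px

    Monotone-⊓ : ∀ a b → P (a ⊓ b) ≡ P a ∧ P b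
    Monotone-⊓ a b with ≤-total a b
    ... | inj₁ a≤b rewrite m≤n⇒m⊓n≡m a≤b = ≤⇒≡∧ a≤b
    ... | inj₂ b≤a rewrite m≥n⇒m⊓n≡n b≤a = trans (≤⇒≡∧ b≤a) (∧-comm (P b) (P a))

    Monotone-⊔ : ∀ a b → P (a ⊔ b) ≡ P a ∨ P b
    Monotone-⊔ a b with ≤-total a b
    ... | inj₁ a≤b rewrite m≤n⇒m⊔n≡n a≤b = ≤⇒≡∨ a≤b
    ... | inj₂ b≤a rewrite m≥n⇒m⊔n≡m b≤a = trans (≤⇒≡∨ b≤a) (∨-comm (P b) (P a))

  run-monotone-image : ∀ {P Q} → Monotone P → Monotone Q → ∀ N f F → (∀ j → P (f j) ≡ Q (F j)) →
                       ∀ j → P (run N f j) ≡ Q (run N F j)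
  run-monotone-image         monoP monoQ []            f F P∘f≗Q∘F = P∘f≗Q∘F
  run-monotone-image {P} {Q} monoP monoQ ((p , q) ∷ N) f F P∘f≗Q∘F =
    run-monotone-image monoP monoQ N (cex (p , q) f) (cex (p , q) F) cex-image
    where
    cex-image : ∀ j → P (cex (p , q) f j) ≡ Q (cex (p , q) F j)
    cex-image j with j ≡ᵇ p
    ... | true  rewrite Monotone-⊓ monoP (f p) (f q) | Monotone-⊓ monoQ (F p) (F q)
                      | P∘f≗Q∘F p | P∘f≗Q∘F q = refl
    ... | false with j ≡ᵇ q
    ...   | true  rewrite Monotone-⊔ monoP (f p) (f q) | Monotone-⊔ monoQ (F p) (F q)
                        | P∘f≗Q∘F p | P∘f≗Q∘F q = refl
    ...   | false = P∘f≗Q∘F j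

  private
    ⟨∧⟩+⟨∨⟩ : ∀ x y → ⟨ x ∧ y ⟩ + ⟨ x ∨ y ⟩ ≡ ⟨ x ⟩ + ⟨ y ⟩
    ⟨∧⟩+⟨∨⟩ true  true  = refl
    ⟨∧⟩+⟨∨⟩ true  false = refl
    ⟨∧⟩+⟨∨⟩ false true  = refl
    ⟨∧⟩+⟨∨⟩ false false = refl

    count-cex-monotone : ∀ {P} → Monotone P → ∀ L p q f → p < L → q < L →
                         count (λ j → P (cex (p , q) f j)) L ≡ count (λ j → P (f j)) L
    count-cex-monotone {P} mono L p q f p<L q<L with p ≟ q
    ... | yes refl = count-ext L (λ j _ → cong P (cex-diagonal j))
      where
      cex-diagonal : ∀ j → cex (p , p) f j ≡ f j
      cex-diagonal j with j ≡ᵇ p in j≡ᵇp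
      ... | true  rewrite ≡ᵇ⇒≡ j p (subst T (sym j≡ᵇp) tt) = ⊓-idem (f p)
      ... | false = refl
    ... | no p≢q = count-update₂ L p q p<L q<L p≢q
      (λ j j≢p j≢q → cong P (cex-other p q f j j≢p j≢q))
      (begin
        ⟨ P (cex (p , q) f p) ⟩ + ⟨ P (cex (p , q) f q) ⟩   ≡⟨ cong₂ (λ x y → ⟨ x ⟩ + ⟨ y ⟩) P-at-p P-at-q ⟩
        ⟨ P (f p) ∧ P (f q) ⟩ + ⟨ P (f p) ∨ P (f q) ⟩       ≡⟨ ⟨∧⟩+⟨∨⟩ (P (f p)) (P (f q)) ⟩
        ⟨ P (f p) ⟩ + ⟨ P (f q) ⟩                           ∎)
      where
      open ≡-Reasoning
      P-at-p : P (cex (p , q) f p) ≡ P (f p) ∧ P (f q)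
      P-at-p rewrite ≡ᵇ-refl p = Monotone-⊓ mono (f p) (f q)
      P-at-q : P (cex (p , q) f q) ≡ P (f p) ∨ P (f q)
      P-at-q rewrite ≢⇒≡ᵇ-false (≢-sym p≢q) | ≡ᵇ-refl q = Monotone-⊔ mono (f p) (f q)

  count-run-monotone : ∀ {P L} → Monotone P → ∀ N → OnWires L N → ∀ f →
                       count (λ j → P (run N f j)) L ≡ count (λ j → P (f j)) L
  count-run-monotone         mono []            _                    f = refl
  count-run-monotone {L = L} mono ((p , q) ∷ N) ((p<L , q<L) ∷ N-on) f =
    trans (count-run-monotone mono N N-on (cex (p , q) f)) (count-cex-monotone mono L p q f p<L q<L)

  count-run-antitone : ∀ {A : ℕ → Bool} {L} → Monotone (λ w → not (A w)) → ∀ N → OnWires L N → ∀ f →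
                       count (λ j → A (run N f j)) L ≡ count (λ j → A (f j)) L
  count-run-antitone {A} {L} anti N N-on f = +-cancelʳ-≡ (count (λ j → not (A (run N f j))) L) _ _ (begin
    count (λ j → A (run N f j)) L + count (λ j → not (A (run N f j))) L ≡⟨ count-not (λ j → A (run N f j)) L ⟩
    L                                                                    ≡⟨ sym (count-not (λ j → A (f j)) L) ⟩
    count (λ j → A (f j)) L + count (λ j → not (A (f j))) L             ≡⟨ cong (count (λ j → A (f j)) L +_)
                                                                              (sym (count-run-monotone {λ w → not (A w)} anti N N-on f)) ⟩
    count (λ j → A (f j)) L + count (λ j → not (A (run N f j))) L       ∎)
    where open ≡-Reasoning

module ZeroOneHalvers where

  open import Data.Nat as ℕ using (ℕ; zero; suc; _+_; _≤_; _<_; _<ᵇ_; _≤ᵇ_; z≤n; z<s)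
  open import Data.Nat.Properties
  open import Data.Bool using (Bool; true; false; not; if_then_else_)
  open import Data.List using (_++_)
  open import Data.Bool.Properties using (not-involutive)
  open import Data.Product using (_×_; _,_; proj₁; proj₂; Σ-syntax)
  open import Data.Sum using (_⊎_; inj₁; inj₂)
  open import Data.Empty using (⊥-elim)
  open import Relation.Binary.Definitions using (Reflexive; Transitive; Total)
  open import Relation.Binary.PropositionalEquality
  open import Data.Rational as ℚ using (ℚ; 0ℚ)
  import Data.Rational.Properties as ℚ
  open import Defs
  open BoolComparisons
  open Networks
  open Counting
  open ZeroOne
  open RationalArith

  ones zeros : (ℕ → Bool) → (ℕ → ℕ) → ℕ → ℕ → ℕ
  ones  P f o L = count (λ j → P (f (o + j))) L
  zeros P f o L = count (λ j → not (P (f (o + j)))) L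

  -- IsHalver restricted to 0-1 inputs, given as a threshold P of an arbitrary input f.
  ZeroOneHalver : ℚ → ℕ → Network → Set
  ZeroOneHalver β m N = ∀ (P : ℕ → Bool) → Monotone P → ∀ f →
    (ones P f 0 (m + m) ≤ m → ℕtoℚ (ones P (run N f) 0 m) ℚ.≤ β ℚ.* ℕtoℚ (ones P f 0 (m + m))) ×
    (zeros P f 0 (m + m) ≤ m → ℕtoℚ (zeros P (run N f) m m) ℚ.≤ β ℚ.* ℕtoℚ (zeros P f 0 (m + m)))

  ones+zeros : ∀ P f o L → ones P f o L + zeros P f o L ≡ L
  ones+zeros P f o L = count-not (λ j → P (f (o + j))) L

  ones-split : ∀ P f o a b → ones P f o (a + b) ≡ ones P f o a + ones P f (o + a) b
  ones-split P f o a b = trans (count-split _ a b)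
    (cong (ones P f o a +_) (count-ext b (λ j _ → cong (λ x → P (f x)) (sym (+-assoc o a j)))))

  zeros-split : ∀ P f o a b → zeros P f o (a + b) ≡ zeros P f o a + zeros P f (o + a) b
  zeros-split P f o a b = trans (count-split _ a b)
    (cong (zeros P f o a +_) (count-ext b (λ j _ → cong (λ x → not (P (f x))) (sym (+-assoc o a j)))))

  ones⇒zeros : ∀ P f g o o′ L → ones P f o L ≡ ones P g o′ L → zeros P f o L ≡ zeros P g o′ L
  ones⇒zeros P f g o o′ L ones≡ = +-cancelˡ-≡ (ones P f o L) _ _
    (trans (ones+zeros P f o L) (trans (sym (ones+zeros P g o′ L)) (cong (_+ zeros P g o′ L) (sym ones≡))))

  module _ {R : ℕ → ℕ → Set} (refl′ : Reflexive R) (trans′ : Transitive R) (total : Total R) where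

    extremum : ∀ (S : ℕ → Bool) (f : ℕ → ℕ) L →
               (∀ j → j < L → S j ≡ false) ⊎
               (Σ[ i ∈ ℕ ] i < L × S i ≡ true × (∀ j → j < L → S j ≡ true → R (f i) (f j)))
    extremum S f zero    = inj₁ (λ _ ())
    extremum S f (suc L) with extremum S f L | S L in SL
    ... | inj₁ none | false = inj₁ none′
      where
      none′ : ∀ j → j < suc L → S j ≡ false
      none′ j j<1+L with m<1+n⇒m<n∨m≡n j<1+L
      ... | inj₁ j<L  = none j j<L
      ... | inj₂ refl = SL
    ... | inj₁ none | true  = inj₂ (L , n<1+n L , SL , least)
      where
      least : ∀ j → j < suc L → S j ≡ true → R (f L) (f j)
      least j j<1+L Sj with m<1+n⇒m<n∨m≡n j<1+L
      ... | inj₁ j<L  = ⊥-elim (true≢false (trans (sym Sj) (none j j<L)))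
      ... | inj₂ refl = refl′
    ... | inj₂ (i , i<L , Si , i-least) | false = inj₂ (i , m<n⇒m<1+n i<L , Si , least)
      where
      least : ∀ j → j < suc L → S j ≡ true → R (f i) (f j)
      least j j<1+L Sj with m<1+n⇒m<n∨m≡n j<1+L
      ... | inj₁ j<L  = i-least j j<L Sj
      ... | inj₂ refl = ⊥-elim (true≢false (trans (sym Sj) SL))
    ... | inj₂ (i , i<L , Si , i-least) | true with total (f i) (f L)
    ...   | inj₁ fi≤fL = inj₂ (i , m<n⇒m<1+n i<L , Si , least)
      where
      least : ∀ j → j < suc L → S j ≡ true → R (f i) (f j)
      least j j<1+L Sj with m<1+n⇒m<n∨m≡n j<1+L
      ... | inj₁ j<L  = i-least j j<L Sj
      ... | inj₂ refl = fi≤fL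
    ...   | inj₂ fL≤fi = inj₂ (L , n<1+n L , SL , least)
      where
      least : ∀ j → j < suc L → S j ≡ true → R (f L) (f j)
      least j j<1+L Sj with m<1+n⇒m<n∨m≡n j<1+L
      ... | inj₁ j<L  = trans′ fL≤fi (i-least j j<L Sj)
      ... | inj₂ refl = refl′

  count-top-≤ : ∀ L f k → DistinctOn L f → count (λ i → count (λ j → f i <ᵇ f j) L <ᵇ k) L ≤ k
  count-top-≤ L f k distinct with extremum ≤-refl ≤-trans ≤-total (λ i → count (λ j → f i <ᵇ f j) L <ᵇ k) f L
  ... | inj₁ none = ≤-trans (≤-reflexive (count-none _ L none)) z≤n
  ... | inj₂ (i₀ , i₀<L , i₀-top , i₀-least) =
    ≤-trans (count-mono-except L i₀ i₀<L above-i₀) (<ᵇ-true⇒< i₀-top)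
    where
    above-i₀ : ∀ j → j < L → j ≢ i₀ → (count (λ j′ → f j <ᵇ f j′) L <ᵇ k) ≡ true → (f i₀ <ᵇ f j) ≡ true
    above-i₀ j j<L j≢i₀ j-top =
      <⇒<ᵇ-true (≤∧≢⇒< (i₀-least j j<L j-top) (λ fi₀≡fj → j≢i₀ (sym (distinct i₀ j i₀<L j<L fi₀≡fj))))

  count-bottom-≤ : ∀ L f k → DistinctOn L f → count (λ i → count (λ j → f j <ᵇ f i) L <ᵇ k) L ≤ k
  count-bottom-≤ L f k distinct
    with extremum (λ {a} → ≤-refl {a}) (λ p q → ≤-trans q p) (λ a b → ≤-total b a)
                  (λ i → count (λ j → f j <ᵇ f i) L <ᵇ k) f L
  ... | inj₁ none = ≤-trans (≤-reflexive (count-none _ L none)) z≤n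
  ... | inj₂ (i₀ , i₀<L , i₀-bottom , i₀-greatest) =
    ≤-trans (count-mono-except L i₀ i₀<L below-i₀) (<ᵇ-true⇒< i₀-bottom)
    where
    below-i₀ : ∀ j → j < L → j ≢ i₀ → (count (λ j′ → f j′ <ᵇ f j) L <ᵇ k) ≡ true → (f j <ᵇ f i₀) ≡ true
    below-i₀ j j<L j≢i₀ j-bottom =
      <⇒<ᵇ-true (≤∧≢⇒< (i₀-greatest j j<L j-bottom) (λ fj≡fi₀ → j≢i₀ (distinct j i₀ j<L i₀<L fj≡fi₀)))

  above-monotone : ∀ c → Monotone (c <ᵇ_)
  above-monotone c v≤w c<v = <⇒<ᵇ-true (<-≤-trans (<ᵇ-true⇒< c<v) v≤w)

  not-below-monotone : ∀ c → Monotone (λ v → not (v <ᵇ c))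
  not-below-monotone c {v} {w} v≤w v≮c =
    cong not (≮⇒<ᵇ-false {w} {c} (λ w<c → true≢false (trans (sym (<⇒<ᵇ-true (≤-<-trans v≤w w<c)))
                                                          (trans (sym (not-involutive (v <ᵇ c))) (cong not v≮c)))))

  zeroOneHalver⇒isHalver : ∀ {E ε} n N → 0ℚ ℚ.≤ E → E ℚ.≤ ε → OnWires (n + n) N →
                           ZeroOneHalver E n N → IsHalver ε n N
  zeroOneHalver⇒isHalver {E} {ε} n N E≥0 E≤ε N-on half f distinct k k≤n = ones-bound , zeros-bound
    where
    L = n + n
    g = run N f

    weaken : ∀ {x′} x t → x′ ≡ x → ℕtoℚ x ℚ.≤ E ℚ.* ℕtoℚ t → t ≤ k → ℕtoℚ x′ ℚ.≤ ε ℚ.* ℕtoℚ k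
    weaken x t refl x≤Et t≤k = ℚ.≤-trans x≤Et (ℚ.≤-trans (*-monoˡ-≤-0≤ E≥0 (ℕtoℚ-mono-≤ t≤k))
      (ℚ.*-monoʳ-≤-nonNeg (ℕtoℚ k) {{ℚ.nonNegative (ℕtoℚ-nonNeg k)}} E≤ε))

    inTop notInBottom : ℕ → Bool
    inTop       v = count (λ j → v <ᵇ f j) L <ᵇ k
    notInBottom v = not (count (λ j → f j <ᵇ v) L <ᵇ k)

    inTop-monotone : Monotone inTop
    inTop-monotone {v} {w} v≤w v-top = <⇒<ᵇ-true {count (λ j → w <ᵇ f j) L} {k} (≤-<-trans
      (count-mono L (λ j _ w<fj → <⇒<ᵇ-true {v} {f j} (≤-<-trans v≤w (<ᵇ-true⇒< w<fj)))) (<ᵇ-true⇒< v-top))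

    notInBottom-monotone : Monotone notInBottom
    notInBottom-monotone {v} {w} v≤w = not-below-monotone k
      (count-mono L (λ j _ fj<v → <⇒<ᵇ-true (<-≤-trans (<ᵇ-true⇒< fj<v) v≤w)))

    ones-bound : ℕtoℚ (count (λ i → nGreater g L i <ᵇ k) n) ℚ.≤ ε ℚ.* ℕtoℚ k
    ones-bound = weaken (ones inTop g 0 n) (ones inTop f 0 L)
      (count-ext n (λ i _ → cong (_<ᵇ k) (count-run-monotone (above-monotone (g i)) N N-on f))) (proj₁ (half inTop inTop-monotone f) (≤-trans top≤k k≤n)) top≤k
      where top≤k = count-top-≤ L f k distinct

    zeros-bound : ℕtoℚ (count (λ i → nSmaller g L (n + i) <ᵇ k) n) ℚ.≤ ε ℚ.* ℕtoℚ k
    zeros-bound = weaken (zeros notInBottom g n n) (zeros notInBottom f 0 L)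
        (count-ext n (λ i _ → trans
          (cong (_<ᵇ k) (count-run-antitone {λ w → w <ᵇ g (n + i)} (not-below-monotone (g (n + i))) N N-on f))
          (sym (not-involutive _))))
        (proj₂ (half notInBottom notInBottom-monotone f) (≤-trans bottom≤k k≤n)) bottom≤k
      where
      bottom≤k : zeros notInBottom f 0 L ≤ k
      bottom≤k = subst (_≤ k) (count-ext L (λ i _ → sym (not-involutive _))) (count-bottom-≤ L f k distinct)

  -- A 0-1 input P ∘ f is encoded as an input with distinct values: the ones of
  -- P ∘ f get the values ≥ L and the zeros the values < L; positions beyond L get 0.
  private
    module Encoding {α : ℚ} (m : ℕ) (L>0 : 0 < m + m) (N : Network) (N-on : OnWires (m + m) N)
      (halver : IsHalver α m N) (P : ℕ → Bool) (mono : Monotone P) (f : ℕ → ℕ) where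
      L = m + m

      F : ℕ → ℕ
      F j = if P (f j) then L + j else (if j <ᵇ L then j else 0)

      high : ℕ → Bool
      high v = L ≤ᵇ v

      high-monotone : Monotone high
      high-monotone {v} {w} v≤w L≤v = ≤⇒≤ᵇ-true {L} {w} (≤-trans (≤ᵇ-true⇒≤ {L} {v} L≤v) v≤w)

      low⇒< : ∀ {v} → high v ≡ false → v < L
      low⇒< {v} v-low = ≰⇒> (λ L≤v → true≢false (trans (sym (≤⇒≤ᵇ-true {L} {v} L≤v)) v-low))

      high∘F : ∀ j → high (F j) ≡ P (f j)
      high∘F j with P (f j) | j <ᵇ L in j<ᵇL
      ... | true  | _     = ≤⇒≤ᵇ-true (m≤m+n L j)
      ... | false | true  = ≰⇒≤ᵇ-false (<⇒≱ (<ᵇ-true⇒< {j} {L} j<ᵇL))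
      ... | false | false = ≰⇒≤ᵇ-false (<⇒≱ L>0)

      F-below : ∀ j → j < L → F j ≡ (if P (f j) then L + j else j)
      F-below j j<L with P (f j)
      ... | true  = refl
      ... | false rewrite <⇒<ᵇ-true j<L = refl

      F-distinct : DistinctOn L F
      F-distinct i j i<L j<L Fi≡Fj =
        distinct (P (f i)) (P (f j)) (trans (sym (F-below i i<L)) (trans Fi≡Fj (F-below j j<L)))
        where
        distinct : ∀ bi bj → (if bi then L + i else i) ≡ (if bj then L + j else j) → i ≡ j
        distinct true  true  eq = +-cancelˡ-≡ L i j eq
        distinct true  false eq = ⊥-elim (<-irrefl (sym eq) (<-≤-trans j<L (m≤m+n L i)))
        distinct false true  eq = ⊥-elim (<-irrefl eq (<-≤-trans i<L (m≤m+n L j)))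
        distinct false false eq = eq

      G g : ℕ → ℕ
      G = run N F
      g = run N f

      high∘G : ∀ j → high (G j) ≡ P (g j)
      high∘G = run-monotone-image high-monotone mono N F f high∘F

      #high : count (λ j → high (G j)) L ≡ ones P f 0 L
      #high = trans (count-run-monotone high-monotone N N-on F) (count-ext L (λ j _ → high∘F j))

      #low : count (λ j → not (high (G j))) L ≡ zeros P f 0 L
      #low = +-cancelˡ-≡ (ones P f 0 L) _ _ (begin
        ones P f 0 L + count (λ j → not (high (G j))) L                ≡⟨ cong (_+ count (λ j → not (high (G j))) L) (sym #high) ⟩
        count (λ j → high (G j)) L + count (λ j → not (high (G j))) L  ≡⟨ count-not (λ j → high (G j)) L ⟩
        L                                                              ≡⟨ sym (ones+zeros P f 0 L) ⟩
        ones P f 0 L + zeros P f 0 L                                   ∎)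
        where open ≡-Reasoning

      -- The T ones of the encoding are exactly its T largest values, and dually.
      top≡high : ∀ i → i < L → (nGreater G L i <ᵇ ones P f 0 L) ≡ high (G i)
      top≡high i i<L with high (G i) in Gi-high
      ... | true  = <⇒<ᵇ-true (≤-trans (count-mono-strict L i i<L above⇒high (≮⇒<ᵇ-false {G i} {G i} (<-irrefl refl)) Gi-high)
                                       (≤-reflexive #high))
        where
        above⇒high : ∀ j → j < L → (G i <ᵇ G j) ≡ true → high (G j) ≡ true
        above⇒high j _ Gi<Gj = ≤⇒≤ᵇ-true {L} {G j} (≤-trans (≤ᵇ-true⇒≤ {L} {G i} Gi-high) (<⇒≤ (<ᵇ-true⇒< Gi<Gj)))
      ... | false = ≮⇒<ᵇ-false (λ #above<T → <-irrefl refl (<-≤-trans #above<T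
                      (subst (_≤ nGreater G L i) #high (count-mono L high⇒above))))
        where
        high⇒above : ∀ j → j < L → high (G j) ≡ true → (G i <ᵇ G j) ≡ true
        high⇒above j _ Gj-high = <⇒<ᵇ-true (<-≤-trans (low⇒< Gi-high) (≤ᵇ-true⇒≤ Gj-high))

      bottom≡low : ∀ i → i < L → (nSmaller G L i <ᵇ zeros P f 0 L) ≡ not (high (G i))
      bottom≡low i i<L with high (G i) in Gi-high
      ... | false = <⇒<ᵇ-true (≤-trans (count-mono-strict L i i<L below⇒low (≮⇒<ᵇ-false {G i} {G i} (<-irrefl refl))
                                                          (cong not Gi-high))
                                       (≤-reflexive #low))
        where
        below⇒low : ∀ j → j < L → (G j <ᵇ G i) ≡ true → not (high (G j)) ≡ true
        below⇒low j _ Gj<Gi = cong not (≰⇒≤ᵇ-false (<⇒≱ (<-trans (<ᵇ-true⇒< Gj<Gi) (low⇒< Gi-high))))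
      ... | true  = ≮⇒<ᵇ-false (λ #below<Z → <-irrefl refl (<-≤-trans #below<Z
                      (subst (_≤ nSmaller G L i) #low (count-mono L low⇒below))))
        where
        low⇒below : ∀ j → j < L → not (high (G j)) ≡ true → (G j <ᵇ G i) ≡ true
        low⇒below j _ Gj-low = <⇒<ᵇ-true (<-≤-trans (low⇒< (trans (sym (not-involutive _)) (cong not Gj-low)))
                                                     (≤ᵇ-true⇒≤ Gi-high))

      ones-bound : ones P f 0 L ≤ m → ℕtoℚ (ones P g 0 m) ℚ.≤ α ℚ.* ℕtoℚ (ones P f 0 L)
      ones-bound T≤m = subst (λ x → ℕtoℚ x ℚ.≤ α ℚ.* ℕtoℚ (ones P f 0 L))
        (count-ext m (λ i i<m → trans (top≡high i (<-≤-trans i<m (m≤m+n m m))) (high∘G i)))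
        (proj₁ (halver F F-distinct (ones P f 0 L) T≤m))

      zeros-bound : zeros P f 0 L ≤ m → ℕtoℚ (zeros P g m m) ℚ.≤ α ℚ.* ℕtoℚ (zeros P f 0 L)
      zeros-bound Z≤m = subst (λ x → ℕtoℚ x ℚ.≤ α ℚ.* ℕtoℚ (zeros P f 0 L))
        (count-ext m (λ i i<m → trans (bottom≡low (m + i) (+-monoʳ-< m i<m)) (cong not (high∘G (m + i)))))
        (proj₂ (halver F F-distinct (zeros P f 0 L) Z≤m))

  isHalver⇒zeroOneHalver : ∀ {α} m N → OnWires (m + m) N → IsHalver α m N → ZeroOneHalver α m N
  isHalver⇒zeroOneHalver {α} zero N _ _ P _ f =
    (λ _ → ℚ.≤-reflexive (sym (ℚ.*-zeroʳ α))) , (λ _ → ℚ.≤-reflexive (sym (ℚ.*-zeroʳ α)))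
  isHalver⇒zeroOneHalver {α} (suc m) N N-on halver P mono f =
    Encoding.ones-bound {α} (suc m) z<s N N-on halver P mono f , Encoding.zeros-bound {α} (suc m) z<s N N-on halver P mono f

  ZeroOneHalver-prefix : ∀ {β m} N₁ {N₂} → OnWires (m + m) N₁ → ZeroOneHalver β m N₂ → ZeroOneHalver β m (N₁ ++ N₂)
  ZeroOneHalver-prefix {β} {m} N₁ {N₂} N₁-on half P mono f = ones-bound , zeros-bound
    where
    g = run N₁ f

    #ones : ones P g 0 (m + m) ≡ ones P f 0 (m + m)
    #ones = count-run-monotone mono N₁ N₁-on f

    #zeros : zeros P g 0 (m + m) ≡ zeros P f 0 (m + m)
    #zeros = ones⇒zeros P g f 0 0 (m + m) #ones

    ones-bound : ones P f 0 (m + m) ≤ m → ℕtoℚ (ones P (run (N₁ ++ N₂) f) 0 m) ℚ.≤ β ℚ.* ℕtoℚ (ones P f 0 (m + m))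
    ones-bound T≤m = subst₂ (λ h t → ℕtoℚ (ones P h 0 m) ℚ.≤ β ℚ.* ℕtoℚ t) (sym (run-++ N₁ N₂ f)) #ones
      (proj₁ (half P mono g) (subst (_≤ m) (sym #ones) T≤m))

    zeros-bound : zeros P f 0 (m + m) ≤ m → ℕtoℚ (zeros P (run (N₁ ++ N₂) f) m m) ℚ.≤ β ℚ.* ℕtoℚ (zeros P f 0 (m + m))
    zeros-bound Z≤m = subst₂ (λ h z → ℕtoℚ (zeros P h m m) ℚ.≤ β ℚ.* ℕtoℚ z) (sym (run-++ N₁ N₂ f)) #zeros
      (proj₂ (half P mono g) (subst (_≤ m) (sym #zeros) Z≤m))

module SegmentBounds where

  open import Data.Nat using (ℕ; _+_; _≤_; _<_)
  open import Data.Nat.Properties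
  open import Data.Bool using (Bool; not)
  open import Data.Product using (_,_; proj₁; proj₂)
  open import Data.Sum using (_⊎_; inj₁; inj₂)
  open import Relation.Binary.PropositionalEquality
  open import Data.Rational as ℚ using (ℚ)
  import Data.Rational.Properties as ℚ
  open import Defs
  open Networks
  open Counting
  open ZeroOne
  open ZeroOneHalvers
  open RationalArith
  open AttenuationInequality using (HalverBound)

  ones+half : ∀ P h o m → ones P h o m + m ≡ ones P h o (m + m) + zeros P h (o + m) m
  ones+half P h o m = begin
    ones P h o m + m                                              ≡⟨ cong (ones P h o m +_) (sym (ones+zeros P h (o + m) m)) ⟩
    ones P h o m + (ones P h (o + m) m + zeros P h (o + m) m)     ≡⟨ sym (+-assoc (ones P h o m) _ _) ⟩
    ones P h o m + ones P h (o + m) m + zeros P h (o + m) m       ≡⟨ cong (_+ zeros P h (o + m) m) (sym (ones-split P h o m m)) ⟩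
    ones P h o (m + m) + zeros P h (o + m) m                      ∎
    where open ≡-Reasoning

  zeros+half : ∀ P h o m → zeros P h (o + m) m + m ≡ zeros P h o (m + m) + ones P h o m
  zeros+half P h o m = begin
    zeros P h (o + m) m + m                                        ≡⟨ cong (zeros P h (o + m) m +_) (sym (ones+zeros P h o m)) ⟩
    zeros P h (o + m) m + (ones P h o m + zeros P h o m)           ≡⟨ cong (zeros P h (o + m) m +_) (+-comm (ones P h o m) _) ⟩
    zeros P h (o + m) m + (zeros P h o m + ones P h o m)           ≡⟨ sym (+-assoc (zeros P h (o + m) m) _ _) ⟩
    zeros P h (o + m) m + zeros P h o m + ones P h o m             ≡⟨ cong (_+ ones P h o m) (+-comm (zeros P h (o + m) m) _) ⟩
    zeros P h o m + zeros P h (o + m) m + ones P h o m             ≡⟨ cong (_+ ones P h o m) (sym (zeros-split P h o m m)) ⟩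
    zeros P h o (m + m) + ones P h o m                             ∎
    where open ≡-Reasoning

  -- x of the t ones land in the first half, y of the z zeros in the second half.
  counts⇒halverBound : ∀ β (m t z x y : ℕ) → t + z ≡ m + m → x + m ≡ t + y →
                (t ≤ m → ℕtoℚ x ℚ.≤ β ℚ.* ℕtoℚ t) → (z ≤ m → ℕtoℚ y ℚ.≤ β ℚ.* ℕtoℚ z) →
                HalverBound β (ℕtoℚ m) (ℕtoℚ t) (ℕtoℚ x)
  counts⇒halverBound β m t z x y t+z≡2m x+m≡t+y x-bound y-bound =
    (λ t≤m → x-bound (ℕtoℚ-cancel-≤ t≤m)) , λ m≤t → begin
      ℕtoℚ x ℚ.+ ℕtoℚ m          ≡⟨ sym (ℕtoℚ-+ x m) ⟩
      ℕtoℚ (x + m)               ≡⟨ cong ℕtoℚ x+m≡t+y ⟩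
      ℕtoℚ (t + y)               ≡⟨ ℕtoℚ-+ t y ⟩
      ℕtoℚ t ℚ.+ ℕtoℚ y          ≤⟨ ℚ.+-monoʳ-≤ (ℕtoℚ t) (y-bound (z≤m (ℕtoℚ-cancel-≤ m≤t))) ⟩
      ℕtoℚ t ℚ.+ β ℚ.* ℕtoℚ z    ≡⟨ cong (λ w → ℕtoℚ t ℚ.+ β ℚ.* w) z≡2m-t ⟩
      ℕtoℚ t ℚ.+ β ℚ.* ((ℕtoℚ m ℚ.+ ℕtoℚ m) ℚ.- ℕtoℚ t) ∎
    where
    open ℚ.≤-Reasoning
    z≤m : m ≤ t → z ≤ m
    z≤m m≤t = +-cancelˡ-≤ m z m (subst (m + z ≤_) t+z≡2m (+-monoˡ-≤ z m≤t))
    z≡2m-t : ℕtoℚ z ≡ (ℕtoℚ m ℚ.+ ℕtoℚ m) ℚ.- ℕtoℚ t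
    z≡2m-t = trans (ℕtoℚ-complement t z t+z≡2m) (cong (ℚ._- ℕtoℚ t) (ℕtoℚ-+ m m))

  HalverBound-subst : ∀ β {m t t′ x} → t ≡ t′ → HalverBound β m (ℕtoℚ t) x → HalverBound β m (ℕtoℚ t′) x
  HalverBound-subst _ refl bound = bound

  module Segment (β : ℚ) (m : ℕ) (N : Network) (half : ZeroOneHalver β m N) (N-on : OnWires (m + m) N)
                 (P : ℕ → Bool) (mono : Monotone P) (o : ℕ) (f : ℕ → ℕ) where

    g : ℕ → ℕ
    g = run (shift o N) f

    private
      F R : ℕ → ℕ
      F j = f (o + j)
      R = run N F

      g-at : ∀ i → g (o + i) ≡ R i
      g-at = run-shift o N f

      g-outside : ∀ j → j < o ⊎ o + (m + m) ≤ j → g j ≡ f j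
      g-outside j (inj₁ j<o)      = run-shift-below o N f j j<o
      g-outside j (inj₂ o+2m≤j) with m≤n⇒∃[o]m+o≡n (≤-trans (m≤m+n o (m + m)) o+2m≤j)
      ... | i , refl = trans (g-at i) (run-outside N N-on F i (+-cancelˡ-≤ o _ _ o+2m≤j))

      #segment : ones P R 0 (m + m) ≡ ones P f o (m + m)
      #segment = count-run-monotone mono N N-on F

    untouched : ∀ (Q : ℕ → Bool) o′ L → o′ + L ≤ o ⊎ o + (m + m) ≤ o′ →
                count (λ j → Q (g (o′ + j))) L ≡ count (λ j → Q (f (o′ + j))) L
    untouched Q o′ L (inj₁ o′+L≤o)  = count-ext L (λ j j<L → cong Q (g-outside (o′ + j)
      (inj₁ (<-≤-trans (+-monoʳ-< o′ j<L) o′+L≤o))))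
    untouched Q o′ L (inj₂ o+2m≤o′) = count-ext L (λ j _ → cong Q (g-outside (o′ + j)
      (inj₂ (≤-trans o+2m≤o′ (m≤m+n o′ j)))))

    preserves-ones : ones P g o (m + m) ≡ ones P f o (m + m)
    preserves-ones = trans (count-ext (m + m) (λ j _ → cong P (g-at j))) #segment

    preserves-zeros : zeros P g o (m + m) ≡ zeros P f o (m + m)
    preserves-zeros = ones⇒zeros P g f o o (m + m) preserves-ones

    private
      ones-first : ones P g o m ≡ ones P R 0 m
      ones-first = count-ext m (λ j _ → cong P (g-at j))

      zeros-second : zeros P g (o + m) m ≡ zeros P R m m
      zeros-second = count-ext m (λ j _ → cong (λ x → not (P x)) (trans (cong g (+-assoc o m j)) (g-at (m + j))))

      t z x y : ℕ
      t = ones P f o (m + m)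
      z = zeros P f o (m + m)
      x = ones P g o m
      y = zeros P g (o + m) m

      x+m≡t+y : x + m ≡ t + y
      x+m≡t+y = trans (ones+half P g o m) (cong (_+ y) preserves-ones)

      y+m≡z+x : y + m ≡ z + x
      y+m≡z+x = trans (zeros+half P g o m) (cong (_+ x) preserves-zeros)

      x-bound : t ≤ m → ℕtoℚ x ℚ.≤ β ℚ.* ℕtoℚ t
      x-bound rewrite ones-first = proj₁ (half P mono F)

      y-bound : z ≤ m → ℕtoℚ y ℚ.≤ β ℚ.* ℕtoℚ z
      y-bound rewrite zeros-second = proj₂ (half P mono F)

    first-half-ones : HalverBound β (ℕtoℚ m) (ℕtoℚ t) (ℕtoℚ x)
    first-half-ones = counts⇒halverBound β m t z x y (ones+zeros P f o (m + m)) x+m≡t+y x-bound y-bound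

    second-half-zeros : HalverBound β (ℕtoℚ m) (ℕtoℚ z) (ℕtoℚ y)
    second-half-zeros = counts⇒halverBound β m z t y x (trans (+-comm z t) (ones+zeros P f o (m + m))) y+m≡z+x y-bound x-bound

module BubbleSort where

  open import Data.Nat using (ℕ; zero; suc; _+_; _∸_; _≤_; _<_; z≤n; s≤s; s≤s⁻¹)
  open import Data.Nat.Properties
  open import Data.Bool using (Bool; true; _∧_; _∨_)
  open import Data.Bool.Properties using (∨-zeroʳ)
  open import Data.Product using (_,_; proj₁; proj₂; Σ-syntax; _×_)
  open import Data.Sum using (inj₁; inj₂)
  open import Data.Empty using (⊥-elim)
  open import Data.List using ([]; _∷_; _++_)
  open import Data.List.Relation.Unary.All using ([]; _∷_)
  open import Relation.Binary.PropositionalEquality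
  open import Defs
  open BoolComparisons using (≡ᵇ-refl; ≢⇒≡ᵇ-false)
  open Networks
  open Counting
  open ZeroOne
  open ZeroOneHalvers
  open RationalArith using (ℕtoℚ-nonNeg; _⊗_)
  open import Data.Rational as ℚ using (0ℚ)

  -- The rounds of Defs.bubble, which are local to its definition; for a numeral n,
  -- bubble n and bubbleRounds n n are definitionally equal.
  bubbleRounds : ℕ → ℕ → Network
  bubbleRounds L zero    = []
  bubbleRounds L (suc r) = adjacent L ++ bubbleRounds L r

  OnWires-adjacent : ∀ m → OnWires (suc m) (adjacent (suc m))
  OnWires-adjacent zero    = []
  OnWires-adjacent (suc m) = OnWires-++ (adjacent (suc m)) _ (OnWires-mono (adjacent (suc m)) (n≤1+n _) (OnWires-adjacent m))
    ((<-trans (n<1+n m) (n<1+n (suc m)) , n<1+n (suc m)) ∷ [])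

  OnWires-bubbleRounds : ∀ m r → OnWires (suc m) (bubbleRounds (suc m) r)
  OnWires-bubbleRounds m zero    = []
  OnWires-bubbleRounds m (suc r) = OnWires-++ (adjacent (suc m)) _ (OnWires-adjacent m) (OnWires-bubbleRounds m r)

  OnesAtEnd : (ℕ → Bool) → ℕ → ℕ → (ℕ → ℕ) → Set
  OnesAtEnd P L s g = ∀ j → j < L → L ≤ j + s → P (g j) ≡ true

  onesAtEnd-0 : ∀ P L g → OnesAtEnd P L 0 g
  onesAtEnd-0 P L g j j<L L≤j+0 = ⊥-elim (<-irrefl refl (<-≤-trans j<L (subst (L ≤_) (+-identityʳ j) L≤j+0)))

  module _ {P : ℕ → Bool} (mono : Monotone P) where

    -- A pass of adjacent compare-exchanges carries the leftmost one it meets up to position k.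
    pass-pushes-one : ∀ m f k → k ≤ m → (∀ j → k < j → j ≤ m → P (f j) ≡ true) →
                      Σ[ j ∈ ℕ ] j ≤ k × P (f j) ≡ true →
                      ∀ j → k ≤ j → j ≤ m → P (run (adjacent (suc m)) f j) ≡ true
    pass-pushes-one zero    f zero _ _ (j₀ , z≤n , Pj₀) zero _ _ = Pj₀
    pass-pushes-one (suc m) f k k≤1+m ones-above (j₀ , j₀≤k , Pj₀) j k≤j j≤1+m
      rewrite run-++ (adjacent (suc m)) ((m , suc m) ∷ []) f = final
      where
      f′ = run (adjacent (suc m)) f

      f′-top : f′ (suc m) ≡ f (suc m)
      f′-top = run-outside (adjacent (suc m)) (OnWires-adjacent m) f (suc m) ≤-refl

      at-m : P (cex (m , suc m) f′ m) ≡ P (f′ m) ∧ P (f (suc m))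
      at-m rewrite ≡ᵇ-refl m | f′-top = Monotone-⊓ mono (f′ m) (f (suc m))

      at-top : P (cex (m , suc m) f′ (suc m)) ≡ P (f′ m) ∨ P (f (suc m))
      at-top rewrite ≢⇒≡ᵇ-false {suc m} {m} (λ eq → <-irrefl (sym eq) (n<1+n m)) | ≡ᵇ-refl (suc m) | f′-top =
        Monotone-⊔ mono (f′ m) (f (suc m))

      below-top : k ≤ m → ∀ j′ → k ≤ j′ → j′ ≤ m → P (f′ j′) ≡ true
      below-top k≤m = pass-pushes-one m f k k≤m
        (λ j′ k<j′ j′≤m → ones-above j′ k<j′ (≤-trans j′≤m (n≤1+n m))) (j₀ , j₀≤k , Pj₀)

      one-reaches-top : (P (f′ m) ∨ P (f (suc m))) ≡ true
      one-reaches-top with m<1+n⇒m<n∨m≡n (s≤s (≤-trans j₀≤k k≤1+m))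
      ... | inj₂ refl rewrite Pj₀ = ∨-zeroʳ (P (f′ m))
      ... | inj₁ j₀<1+m rewrite pass-pushes-one m f m ≤-refl
              (λ j m<j j≤m → ⊥-elim (<-irrefl refl (<-≤-trans m<j j≤m))) (j₀ , s≤s⁻¹ j₀<1+m , Pj₀) m ≤-refl ≤-refl = refl

      final : P (cex (m , suc m) f′ j) ≡ true
      final with m<1+n⇒m<n∨m≡n (s≤s k≤1+m)
      ... | inj₂ refl with ≤-antisym k≤j j≤1+m
      ...   | refl rewrite at-top = one-reaches-top
      final | inj₁ k<1+m with m<1+n⇒m<n∨m≡n (s≤s j≤1+m)
      ... | inj₂ refl rewrite at-top | ones-above (suc m) k<1+m ≤-refl = ∨-zeroʳ (P (f′ m))
      ... | inj₁ j<1+m with m<1+n⇒m<n∨m≡n j<1+m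
      ...   | inj₂ refl rewrite at-m | ones-above (suc m) k<1+m ≤-refl | below-top (s≤s⁻¹ k<1+m) m k≤j ≤-refl = refl
      ...   | inj₁ j<m rewrite cex-other m (suc m) f′ j (λ eq → <-irrefl eq j<m) (λ eq → <-irrefl eq (<-trans j<m (n<1+n m))) =
        below-top (s≤s⁻¹ k<1+m) j k≤j (<⇒≤ j<m)

    onesAtEnd-weaken : ∀ {L s s′ g} → s′ ≤ s → OnesAtEnd P L s g → OnesAtEnd P L s′ g
    onesAtEnd-weaken s′≤s top j j<L L≤j+s′ = top j j<L (≤-trans L≤j+s′ (+-monoʳ-≤ j s′≤s))

    pass-extends : ∀ m (g : ℕ → ℕ) s → s ≤ m → OnesAtEnd P (suc m) s g → Σ[ j ∈ ℕ ] j ≤ m ∸ s × P (g j) ≡ true →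
                   OnesAtEnd P (suc m) (suc s) (run (adjacent (suc m)) g)
    pass-extends m g s s≤m top one j j<1+m 1+m≤j+1+s =
      pass-pushes-one m g k (m∸n≤m m s) ones-above one j k≤j (s≤s⁻¹ j<1+m)
      where
      k = m ∸ s
      k+s≡m : k + s ≡ m
      k+s≡m = m∸n+n≡m s≤m
      ones-above : ∀ j → k < j → j ≤ m → P (g j) ≡ true
      ones-above j k<j j≤m = top j (s≤s j≤m) (subst (_≤ j + s) (cong suc k+s≡m) (+-monoˡ-≤ s k<j))
      k≤j : k ≤ j
      k≤j = +-cancelʳ-≤ s k j (subst (_≤ j + s) (sym k+s≡m) (s≤s⁻¹ (subst (suc m ≤_) (+-suc j s) 1+m≤j+1+s)))

    one-below : ∀ m (g : ℕ → ℕ) s → s < count (λ j → P (g j)) (suc m) → Σ[ j ∈ ℕ ] j ≤ m ∸ s × P (g j) ≡ true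
    one-below m g s s<T = j , s≤s⁻¹ j<1+k , Pj
      where
      k = m ∸ s
      s≤m : s ≤ m
      s≤m = s≤s⁻¹ (<-≤-trans s<T (count-≤ _ (suc m)))
      T≤#below+s : count (λ j → P (g j)) (suc m) ≤ count (λ j → P (g j)) (suc k) + s
      T≤#below+s = subst (λ x → count (λ j → P (g j)) x ≤ count (λ j → P (g j)) (suc k) + s)
                     (cong suc (m∸n+n≡m s≤m)) (count-split-≤ (λ j → P (g j)) (suc k) s)
      #ones-below>0 : 0 < count (λ j → P (g j)) (suc k)
      #ones-below>0 = n≢0⇒n>0 (λ #≡0 → <-irrefl refl (<-≤-trans s<T
                        (subst (λ x → count (λ j → P (g j)) (suc m) ≤ x + s) #≡0 T≤#below+s)))
      witness = count-pos (λ j → P (g j)) (suc k) #ones-below>0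
      j = proj₁ witness
      j<1+k = proj₁ (proj₂ witness)
      Pj = proj₂ (proj₂ witness)

    pass-keeps : ∀ m (g : ℕ → ℕ) s → s ≤ suc m → OnesAtEnd P (suc m) s g → OnesAtEnd P (suc m) s (run (adjacent (suc m)) g)
    pass-keeps m g zero    _     _   = onesAtEnd-0 P (suc m) _
    pass-keeps m g (suc t) t<1+m top = pass-extends m g t (s≤s⁻¹ t<1+m) (onesAtEnd-weaken (n≤1+n t) top)
      (m ∸ t , ≤-refl , top (m ∸ t) (s≤s (m∸n≤m m t))
        (≤-reflexive (trans (cong suc (sym (m∸n+n≡m (s≤s⁻¹ t<1+m)))) (sym (+-suc (m ∸ t) t)))))

    bubbleRounds-sorts : ∀ m T r (g : ℕ → ℕ) s → count (λ j → P (g j)) (suc m) ≡ T → OnesAtEnd P (suc m) s g →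
                         s ≤ T → T ≤ s + r → OnesAtEnd P (suc m) T (run (bubbleRounds (suc m) r) g)
    bubbleRounds-sorts m T zero    g s #≡T top s≤T T≤s+0 rewrite ≤-antisym s≤T (subst (T ≤_) (+-identityʳ s) T≤s+0) = top
    bubbleRounds-sorts m T (suc r) g s #≡T top s≤T T≤s+1+r rewrite run-++ (adjacent (suc m)) (bubbleRounds (suc m) r) g
      with m≤n⇒m<n∨m≡n s≤T
    ... | inj₁ s<T = bubbleRounds-sorts m T r g₁ (suc s) #₁≡T
                       (pass-extends m g s (s≤s⁻¹ (<-≤-trans s<T T≤1+m)) top (one-below m g s (subst (s <_) (sym #≡T) s<T)))
                       s<T (subst (T ≤_) (+-suc s r) T≤s+1+r)
      where
      g₁ = run (adjacent (suc m)) g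
      T≤1+m = subst (_≤ suc m) #≡T (count-≤ _ (suc m))
      #₁≡T = trans (count-run-monotone mono (adjacent (suc m)) (OnWires-adjacent m) g) #≡T
    ... | inj₂ refl = bubbleRounds-sorts m s r g₁ s #₁≡s (pass-keeps m g s s≤1+m top) ≤-refl (m≤m+n s r)
      where
      g₁ = run (adjacent (suc m)) g
      s≤1+m = subst (_≤ suc m) #≡T (count-≤ _ (suc m))
      #₁≡s = trans (count-run-monotone mono (adjacent (suc m)) (OnWires-adjacent m) g) #≡T

    bubble-sorts : ∀ m (g : ℕ → ℕ) → OnesAtEnd P (suc m) (count (λ j → P (g j)) (suc m)) (run (bubbleRounds (suc m) (suc m)) g)
    bubble-sorts m g = bubbleRounds-sorts m _ (suc m) g 0 refl (onesAtEnd-0 P (suc m) g) z≤n (count-≤ _ (suc m))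

  bubble-zeroOneHalver : ∀ {E} n → 0ℚ ℚ.≤ E → ZeroOneHalver E (suc n) (bubbleRounds (suc n + suc n) (suc n + suc n))
  bubble-zeroOneHalver {E} n′ E≥0 P mono f = ones-bound , zeros-bound
    where
    n = suc n′
    L = n + n
    g = run (bubbleRounds L L) f
    T = ones P f 0 L

    sorted : OnesAtEnd P L T g
    sorted = bubble-sorts mono (n′ + n) f

    #ones : ones P g 0 L ≡ T
    #ones = count-run-monotone mono (bubbleRounds L L) (OnWires-bubbleRounds (n′ + n) L) f

    no-ones-in-front : T ≤ n → ones P g 0 n ≡ 0
    no-ones-in-front T≤n = +-cancelʳ-≡ (ones P g n n) (ones P g 0 n) 0 (≤-antisym front+back≤back (m≤n+m (0 + ones P g n n) (ones P g 0 n)))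
      where
      T≤back : T ≤ ones P g n n
      T≤back = subst (_≤ ones P g n n) (m∸[m∸n]≡n T≤n)
        (count-suffix _ n (n ∸ T) (m∸n≤m n T) (λ j j<n n∸T≤j → sorted (n + j) (+-monoʳ-< n j<n)
          (subst (L ≤_) (sym (+-assoc n j T)) (+-monoʳ-≤ n (subst (_≤ j + T) (m∸n+n≡m T≤n) (+-monoˡ-≤ T n∸T≤j))))))
      front+back≤back : ones P g 0 n + ones P g n n ≤ 0 + ones P g n n
      front+back≤back = subst (_≤ ones P g n n) (trans (sym #ones) (ones-split P g 0 n n)) T≤back

    no-zeros-behind : zeros P f 0 L ≤ n → zeros P g n n ≡ 0
    no-zeros-behind Z≤n = +-cancelˡ-≡ n (zeros P g n n) 0
      (trans (cong (_+ zeros P g n n) (sym back-all-ones)) (trans (ones+zeros P g n n) (sym (+-identityʳ n))))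
      where
      n≤T : n ≤ T
      n≤T = +-cancelʳ-≤ (zeros P f 0 L) n T
        (subst (n + zeros P f 0 L ≤_) (sym (ones+zeros P f 0 L)) (+-monoʳ-≤ n Z≤n))
      back-all-ones : ones P g n n ≡ n
      back-all-ones = count-all _ n (λ j j<n → sorted (n + j) (+-monoʳ-< n j<n)
        (subst (L ≤_) (sym (+-assoc n j T)) (+-monoʳ-≤ n (≤-trans n≤T (m≤n+m T j)))))

    ones-bound : T ≤ n → ℕtoℚ (ones P g 0 n) ℚ.≤ E ℚ.* ℕtoℚ T
    ones-bound T≤n = subst (λ x → ℕtoℚ x ℚ.≤ E ℚ.* ℕtoℚ T) (sym (no-ones-in-front T≤n)) (E≥0 ⊗ ℕtoℚ-nonNeg T)

    zeros-bound : zeros P f 0 L ≤ n → ℕtoℚ (zeros P g n n) ℚ.≤ E ℚ.* ℕtoℚ (zeros P f 0 L)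
    zeros-bound Z≤n = subst (λ x → ℕtoℚ x ℚ.≤ E ℚ.* ℕtoℚ (zeros P f 0 L)) (sym (no-zeros-behind Z≤n))
      (E≥0 ⊗ ℕtoℚ-nonNeg (zeros P f 0 L))

module AttenuationCounts where

  open import Data.Nat as ℕ using (ℕ; _+_)
  open import Data.Integer using (+_)
  open import Data.Rational using (ℚ; 0ℚ; _≤_; _<_; _*_; _-_; _/_) renaming (_+_ to _+ℚ_)
  open import Relation.Binary.PropositionalEquality
  open import Defs using (ℕtoℚ)
  open RationalArith
  open AttenuationInequality

  -- The counts of one step of Attenuate, named as in AttenuationInequality;
  -- rest-of-x is what remains of x once the part named in x-split is taken out.
  record AttenuationCounts (α E : ℚ) (q : ℕ) : Set where
    field
      s a a₁ b₁ a₂ a₂₁ b₁₁ a₂₂ rest-of-s rest-of-a rest-of-c rest-of-a₂ : ℕ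
      s-split  : a + rest-of-s ≡ s
      a-split  : a₁ + rest-of-a ≡ a
      c-split  : a₂ + rest-of-c ≡ rest-of-a + b₁
      a₂-split : a₂₁ + rest-of-a₂ ≡ a₂
      s≤4q     : s ℕ.≤ (q + q) + (q + q)
      a≤αs     : ℕtoℚ a ≤ α * ℕtoℚ s
      A₁-bound  : HalverBound α (ℕtoℚ (q + q)) (ℕtoℚ a) (ℕtoℚ a₁)
      B₁-bound  : HalverBound α (ℕtoℚ (q + q)) (ℕtoℚ rest-of-s) (ℕtoℚ b₁)
      A₂-bound  : HalverBound E (ℕtoℚ (q + q)) (ℕtoℚ (rest-of-a + b₁)) (ℕtoℚ a₂)
      A₂₁-bound : HalverBound α (ℕtoℚ q) (ℕtoℚ a₂) (ℕtoℚ a₂₁)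
      B₁₁-bound : HalverBound α (ℕtoℚ q) (ℕtoℚ rest-of-c) (ℕtoℚ b₁₁)
      A₂₂-bound : HalverBound E (ℕtoℚ q) (ℕtoℚ (rest-of-a₂ + b₁₁)) (ℕtoℚ a₂₂)

  private
    HalverBound-cong : ∀ {β m m′ t t′ x} → m ≡ m′ → t ≡ t′ → HalverBound β m t x → HalverBound β m′ t′ x
    HalverBound-cong refl refl bound = bound

  attenuation-bound : ∀ {α E q} → 0ℚ ≤ α → α ≤ + 1 / 8 → 0ℚ ≤ E → E ≤ + 1 / 8 → + 3 / 1 * (α * α) ≤ E → 0ℚ < ℕtoℚ q →
                      (counts : AttenuationCounts α E q) → let open AttenuationCounts counts in
                      ℕtoℚ ((a₁ + a₂₁) + a₂₂) ≤ E * ℕtoℚ s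
  attenuation-bound {α} {E} {q} α≥0 α≤⅛ E≥0 E≤⅛ 3α²≤E q>0 counts =
    subst (_≤ E * ℕtoℚ s) (sym (trans (ℕtoℚ-+ (a₁ + a₂₁) a₂₂) (cong (_+ℚ ℕtoℚ a₂₂) (ℕtoℚ-+ a₁ a₂₁))))
      (attenuation-inequality α E (ℕtoℚ q) (ℕtoℚ s) (ℕtoℚ a) (ℕtoℚ a₁) (ℕtoℚ b₁) (ℕtoℚ a₂) (ℕtoℚ a₂₁) (ℕtoℚ b₁₁) (ℕtoℚ a₂₂)
        α≥0 α≤⅛ E≥0 E≤⅛ 3α²≤E q>0 (ℕtoℚ-nonNeg a₁) (subst (0ℚ ≤_) rest-of-a≡ (ℕtoℚ-nonNeg rest-of-a))
        (subst (0ℚ ≤_) rest-of-s≡ (ℕtoℚ-nonNeg rest-of-s)) (ℕtoℚ-nonNeg b₁) (ℕtoℚ-nonNeg a₂)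
        (subst (0ℚ ≤_) rest-of-c≡ (ℕtoℚ-nonNeg rest-of-c)) (ℕtoℚ-nonNeg a₂₁)
        (subst (ℕtoℚ s ≤_) 4q≡ (ℕtoℚ-mono-≤ s≤4q)) a≤αs
        (HalverBound-cong {α} 2q≡ refl A₁-bound) (HalverBound-cong {α} 2q≡ rest-of-s≡ B₁-bound)
        (HalverBound-cong {E} 2q≡ c≡ A₂-bound) A₂₁-bound
        (HalverBound-cong {α} refl rest-of-c≡ B₁₁-bound) (HalverBound-cong {E} refl c′≡ A₂₂-bound))
    where
    open AttenuationCounts counts
    2q≡ : ℕtoℚ (q + q) ≡ ℕtoℚ q +ℚ ℕtoℚ q
    2q≡ = ℕtoℚ-+ q q
    4q≡ : ℕtoℚ ((q + q) + (q + q)) ≡ (ℕtoℚ q +ℚ ℕtoℚ q) +ℚ (ℕtoℚ q +ℚ ℕtoℚ q)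
    4q≡ = trans (ℕtoℚ-+ (q + q) (q + q)) (cong₂ _+ℚ_ 2q≡ 2q≡)
    rest-of-s≡ : ℕtoℚ rest-of-s ≡ ℕtoℚ s - ℕtoℚ a
    rest-of-s≡ = ℕtoℚ-complement a rest-of-s s-split
    rest-of-a≡ : ℕtoℚ rest-of-a ≡ ℕtoℚ a - ℕtoℚ a₁
    rest-of-a≡ = ℕtoℚ-complement a₁ rest-of-a a-split
    c≡ : ℕtoℚ (rest-of-a + b₁) ≡ (ℕtoℚ a - ℕtoℚ a₁) +ℚ ℕtoℚ b₁
    c≡ = trans (ℕtoℚ-+ rest-of-a b₁) (cong (_+ℚ ℕtoℚ b₁) rest-of-a≡)
    rest-of-c≡ : ℕtoℚ rest-of-c ≡ ((ℕtoℚ a - ℕtoℚ a₁) +ℚ ℕtoℚ b₁) - ℕtoℚ a₂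
    rest-of-c≡ = trans (ℕtoℚ-complement a₂ rest-of-c c-split) (cong (_- ℕtoℚ a₂) c≡)
    c′≡ : ℕtoℚ (rest-of-a₂ + b₁₁) ≡ (ℕtoℚ a₂ - ℕtoℚ a₂₁) +ℚ ℕtoℚ b₁₁
    c′≡ = trans (ℕtoℚ-+ rest-of-a₂ b₁₁) (cong (_+ℚ ℕtoℚ b₁₁) (ℕtoℚ-complement a₂₁ rest-of-a₂ a₂-split))

module AttenuateStep where

  open import Data.Nat using (ℕ; _+_; _≤_; _<_)
  open import Data.Nat.Properties
  open import Data.Bool using (Bool; not)
  open import Data.Product using (_,_; proj₁; proj₂)
  open import Data.Sum using (inj₁; inj₂)
  open import Data.List using (_++_)
  open import Data.Integer using (+_)
  open import Data.Rational as ℚ using (ℚ; 0ℚ; _/_)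
  import Data.Rational.Properties as ℚ
  open import Relation.Binary.PropositionalEquality
  open import Defs
  open Networks
  open ZeroOne
  open ZeroOneHalvers
  open RationalArith using (ℕtoℚ-cancel-≤)
  open SegmentBounds
  open AttenuationCounts

  -- The last clause of Defs.attenuate, with its h and q as parameters.
  attenuateStep : Network → Network → Network → Network → ℕ → ℕ → Network
  attenuateStep Nh Ah Nq Aq h q =
       shift 0       Nh
    ++ shift (h + h) Nh
    ++ shift h       Nh
    ++ shift h       Ah
    ++ shift h       Nq
    ++ shift (h + h) Nq
    ++ shift (h + q) Nq
    ++ shift (h + q) Aq

  OnWires-attenuateStep : ∀ q {Nh Ah Nq Aq} → OnWires ((q + q) + (q + q)) Nh → OnWires ((q + q) + (q + q)) Ah →
                          OnWires (q + q) Nq → OnWires (q + q) Aq →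
                          OnWires (((q + q) + (q + q)) + ((q + q) + (q + q))) (attenuateStep Nh Ah Nq Aq (q + q) q)
  OnWires-attenuateStep q {Nh} {Ah} {Nq} {Aq} Nh-on Ah-on Nq-on Aq-on =
    OnWires-++ (shift 0 Nh) _ (OnWires-mono (shift 0 Nh) (m≤m+n _ _) (OnWires-shift 0 Nh Nh-on))
    (OnWires-++ (shift (h + h) Nh) _ (OnWires-shift (h + h) Nh Nh-on)
    (OnWires-++ (shift h Nh) _ (OnWires-mono (shift h Nh) h+2h≤4h (OnWires-shift h Nh Nh-on))
    (OnWires-++ (shift h Ah) _ (OnWires-mono (shift h Ah) h+2h≤4h (OnWires-shift h Ah Ah-on))
    (OnWires-++ (shift h Nq) _ (OnWires-mono (shift h Nq) (m≤m+n (h + h) (h + h)) (OnWires-shift h Nq Nq-on))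
    (OnWires-++ (shift (h + h) Nq) _ (OnWires-mono (shift (h + h) Nq) (+-monoʳ-≤ (h + h) (m≤m+n h h))
                                                   (OnWires-shift (h + h) Nq Nq-on))
    (OnWires-++ (shift (h + q) Nq) _ (OnWires-mono (shift (h + q) Nq) h+q+2q≤4h (OnWires-shift (h + q) Nq Nq-on))
                (OnWires-mono (shift (h + q) Aq) h+q+2q≤4h (OnWires-shift (h + q) Aq Aq-on))))))))
    where
    h = q + q
    h+2h≤4h : h + (h + h) ≤ (h + h) + (h + h)
    h+2h≤4h = +-monoˡ-≤ (h + h) (m≤m+n h h)
    h+q+2q≤4h : (h + q) + (q + q) ≤ (h + h) + (h + h)
    h+q+2q≤4h = ≤-trans (≤-reflexive (trans (sym (+-assoc (h + q) q q)) (cong (_+ q) (+-assoc h q q))))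
                        (+-monoʳ-≤ (h + h) (≤-trans (m≤m+n q q) (m≤m+n h h)))

  module Step {α E : ℚ} (α≥0 : 0ℚ ℚ.≤ α) (α≤⅛ : α ℚ.≤ + 1 / 8) (E≥0 : 0ℚ ℚ.≤ E) (E≤⅛ : E ℚ.≤ + 1 / 8)
    (3α²≤E : + 3 / 1 ℚ.* (α ℚ.* α) ℚ.≤ E) (q : ℕ) (q>0 : 0 < q) (K Nh Ah Nq Aq : Network)
    (K-half : ZeroOneHalver α ((q + q) + (q + q)) K) (K-on : OnWires (((q + q) + (q + q)) + ((q + q) + (q + q))) K)
    (Nh-half : ZeroOneHalver α (q + q) Nh) (Nh-on : OnWires ((q + q) + (q + q)) Nh)
    (NAh-half : ZeroOneHalver E (q + q) (Nh ++ Ah)) (NAh-on : OnWires ((q + q) + (q + q)) (Nh ++ Ah))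
    (Nq-half : ZeroOneHalver α q Nq) (Nq-on : OnWires (q + q) Nq)
    (NAq-half : ZeroOneHalver E q (Nq ++ Aq)) (NAq-on : OnWires (q + q) (Nq ++ Aq)) where

    h L : ℕ
    h = q + q
    L = (h + h) + (h + h)

    private
      h+q+q≡h+h : (h + q) + q ≡ h + h
      h+q+q≡h+h = +-assoc h q q

      h+q+2q≡h+h+q : (h + q) + (q + q) ≡ (h + h) + q
      h+q+2q≡h+h+q = trans (sym (+-assoc (h + q) q q)) (cong (_+ q) h+q+q≡h+h)

      q>0′ : 0ℚ ℚ.< ℕtoℚ q
      q>0′ = ℚ.≰⇒> (λ q≤0 → <-irrefl refl (<-≤-trans q>0 (ℕtoℚ-cancel-≤ {q} {0} q≤0)))

    module Stages (P : ℕ → Bool) (mono : Monotone P) (f : ℕ → ℕ) where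
      f₁ : ℕ → ℕ
      f₁ = run K f
      module S₁ = Segment α h Nh        Nh-half  Nh-on  P mono 0       f₁
      module S₂ = Segment α h Nh        Nh-half  Nh-on  P mono (h + h) S₁.g
      module S₃ = Segment E h (Nh ++ Ah) NAh-half NAh-on P mono h       S₂.g
      module S₄ = Segment α q Nq        Nq-half  Nq-on  P mono h       S₃.g
      module S₅ = Segment α q Nq        Nq-half  Nq-on  P mono (h + h) S₄.g
      module S₆ = Segment E q (Nq ++ Aq) NAq-half NAq-on P mono (h + q) S₅.g

      f₂ f₃ f₄ f₅ f₆ f₇ : ℕ → ℕ
      f₂ = S₁.g
      f₃ = S₂.g
      f₄ = S₃.g
      f₅ = S₄.g
      f₆ = S₅.g
      f₇ = S₆.g

      run≡f₇ : run (K ++ attenuateStep Nh Ah Nq Aq h q) f ≡ f₇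
      run≡f₇ = begin
        run (K ++ attenuateStep Nh Ah Nq Aq h q) f                    ≡⟨ run-++ K _ f ⟩
        run (attenuateStep Nh Ah Nq Aq h q) f₁                        ≡⟨ run-++ (shift 0 Nh) _ f₁ ⟩
        run (shift (h + h) Nh ++ shift h Nh ++ shift h Ah ++ R₄) f₂    ≡⟨ run-++ (shift (h + h) Nh) _ f₂ ⟩
        run (shift h Nh ++ shift h Ah ++ R₄) f₃                       ≡⟨ sym (cong (λ N → run N f₃) (++-assoc (shift h Nh) (shift h Ah) R₄)) ⟩
        run ((shift h Nh ++ shift h Ah) ++ R₄) f₃                     ≡⟨ cong (λ N → run (N ++ R₄) f₃) (sym (shift-++ h Nh Ah)) ⟩
        run (shift h (Nh ++ Ah) ++ R₄) f₃                             ≡⟨ run-++ (shift h (Nh ++ Ah)) R₄ f₃ ⟩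
        run R₄ f₄                                                     ≡⟨ run-++ (shift h Nq) _ f₄ ⟩
        run (shift (h + h) Nq ++ shift (h + q) Nq ++ shift (h + q) Aq) f₅ ≡⟨ run-++ (shift (h + h) Nq) _ f₅ ⟩
        run (shift (h + q) Nq ++ shift (h + q) Aq) f₆                 ≡⟨ cong (λ N → run N f₆) (sym (shift-++ (h + q) Nq Aq)) ⟩
        f₇                                                            ∎
        where
        open ≡-Reasoning
        open import Data.List.Properties using (++-assoc)
        R₄ = shift h Nq ++ shift (h + h) Nq ++ shift (h + q) Nq ++ shift (h + q) Aq

      ones-counts : ones P f 0 L ≤ h + h → AttenuationCounts α E q
      ones-counts s≤4q = record
        { s = ones P f 0 L ; a = ones P f₁ 0 (h + h) ; a₁ = ones P f₂ 0 h ; b₁ = ones P f₃ (h + h) h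
        ; a₂ = ones P f₄ h h ; a₂₁ = ones P f₅ h q ; b₁₁ = ones P f₆ (h + h) q ; a₂₂ = ones P f₇ (h + q) q
        ; rest-of-s = ones P f₁ (h + h) (h + h) ; rest-of-a = ones P f₂ h h
        ; rest-of-c = ones P f₄ (h + h) h ; rest-of-a₂ = ones P f₅ (h + q) q
        ; s-split  = trans (sym (ones-split P f₁ 0 (h + h) (h + h))) (count-run-monotone mono K K-on f)
        ; a-split  = trans (sym (ones-split P f₂ 0 h h)) S₁.preserves-ones
        ; c-split  = trans (sym (ones-split P f₄ h h h)) (trans S₃.preserves-ones A₂∪B₁)
        ; a₂-split = trans (sym (ones-split P f₅ h q q)) S₄.preserves-ones
        ; s≤4q     = s≤4q
        ; a≤αs     = proj₁ (K-half P mono f) s≤4q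
        ; A₁-bound  = S₁.first-half-ones
        ; B₁-bound  = HalverBound-subst α (S₁.untouched P (h + h) (h + h) (inj₂ ≤-refl)) S₂.first-half-ones
        ; A₂-bound  = HalverBound-subst E A₂∪B₁ S₃.first-half-ones
        ; A₂₁-bound = S₄.first-half-ones
        ; B₁₁-bound = HalverBound-subst α (S₄.untouched P (h + h) h (inj₂ ≤-refl)) S₅.first-half-ones
        ; A₂₂-bound = HalverBound-subst E A₂₂∪B₁₁ S₆.first-half-ones
        }
        where
        A₂∪B₁ : ones P f₃ h (h + h) ≡ ones P f₂ h h + ones P f₃ (h + h) h
        A₂∪B₁ = trans (ones-split P f₃ h h h) (cong (_+ ones P f₃ (h + h) h) (S₂.untouched P h h (inj₁ ≤-refl)))
        A₂₂∪B₁₁ : ones P f₆ (h + q) (q + q) ≡ ones P f₅ (h + q) q + ones P f₆ (h + h) q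
        A₂₂∪B₁₁ = trans (ones-split P f₆ (h + q) q q)
          (cong₂ _+_ (S₅.untouched P (h + q) q (inj₁ (≤-reflexive h+q+q≡h+h))) (cong (λ o → ones P f₆ o q) h+q+q≡h+h))

      ones-left-in-A : ones P f₇ 0 (h + h) ≡ (ones P f₂ 0 h + ones P f₅ h q) + ones P f₇ (h + q) q
      ones-left-in-A = begin
        ones P f₇ 0 (h + h)                                          ≡⟨ ones-split P f₇ 0 h h ⟩
        ones P f₇ 0 h + ones P f₇ h (q + q)                          ≡⟨ cong (λ x → ones P f₇ 0 h + x) (ones-split P f₇ h q q) ⟩
        ones P f₇ 0 h + (ones P f₇ h q + ones P f₇ (h + q) q)        ≡⟨ sym (+-assoc (ones P f₇ 0 h) _ _) ⟩
        ones P f₇ 0 h + ones P f₇ h q + ones P f₇ (h + q) q          ≡⟨ cong₂ (λ x y → x + y + ones P f₇ (h + q) q) A₁-final A₂₁-final ⟩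
        ones P f₂ 0 h + ones P f₅ h q + ones P f₇ (h + q) q          ∎
        where
        open ≡-Reasoning
        A₁-final : ones P f₇ 0 h ≡ ones P f₂ 0 h
        A₁-final = trans (S₆.untouched P 0 h (inj₁ (m≤m+n h q)))
          (trans (S₅.untouched P 0 h (inj₁ (m≤m+n h h))) (trans (S₄.untouched P 0 h (inj₁ ≤-refl))
          (trans (S₃.untouched P 0 h (inj₁ ≤-refl)) (S₂.untouched P 0 h (inj₁ (m≤m+n h h))))))
        A₂₁-final : ones P f₇ h q ≡ ones P f₅ h q
        A₂₁-final = trans (S₆.untouched P h q (inj₁ ≤-refl)) (S₅.untouched P h q (inj₁ (+-monoʳ-≤ h (m≤m+n q q))))

      zeros-counts : zeros P f 0 L ≤ h + h → AttenuationCounts α E q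
      zeros-counts s≤4q = record
        { s = zeros P f 0 L ; a = zeros P f₁ (h + h) (h + h) ; a₁ = zeros P f₃ ((h + h) + h) h
        ; b₁ = zeros P f₂ h h ; a₂ = zeros P f₄ (h + h) h ; a₂₁ = zeros P f₆ ((h + h) + q) q
        ; b₁₁ = zeros P f₅ (h + q) q ; a₂₂ = zeros P f₇ ((h + q) + q) q
        ; rest-of-s = zeros P f₁ 0 (h + h) ; rest-of-a = zeros P f₃ (h + h) h
        ; rest-of-c = zeros P f₄ h h ; rest-of-a₂ = zeros P f₆ (h + h) q
        ; s-split  = trans (+-comm _ (zeros P f₁ 0 (h + h))) (trans (sym (zeros-split P f₁ 0 (h + h) (h + h)))
                       (ones⇒zeros P f₁ f 0 0 L (count-run-monotone mono K K-on f)))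
        ; a-split  = trans (+-comm _ (zeros P f₃ (h + h) h)) (trans (sym (zeros-split P f₃ (h + h) h h))
                       (trans S₂.preserves-zeros B-untouched))
        ; c-split  = trans (+-comm _ (zeros P f₄ h h)) (trans (sym (zeros-split P f₄ h h h))
                       (trans S₃.preserves-zeros B₁∪A₂))
        ; a₂-split = trans (+-comm _ (zeros P f₆ (h + h) q)) (trans (sym (zeros-split P f₆ (h + h) q q))
                       (trans S₅.preserves-zeros (S₄.untouched (λ x → not (P x)) (h + h) (q + q) (inj₂ ≤-refl))))
        ; s≤4q     = s≤4q
        ; a≤αs     = proj₂ (K-half P mono f) s≤4q
        ; A₁-bound  = HalverBound-subst α B-untouched S₂.second-half-zeros
        ; B₁-bound  = S₁.second-half-zeros
        ; A₂-bound  = HalverBound-subst E B₁∪A₂ S₃.second-half-zeros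
        ; A₂₁-bound = HalverBound-subst α (S₄.untouched (λ x → not (P x)) (h + h) (q + q) (inj₂ ≤-refl)) S₅.second-half-zeros
        ; B₁₁-bound = S₄.second-half-zeros
        ; A₂₂-bound = HalverBound-subst E B₁₁∪A₂₂ S₆.second-half-zeros
        }
        where
        B-untouched : zeros P f₂ (h + h) (h + h) ≡ zeros P f₁ (h + h) (h + h)
        B-untouched = S₁.untouched (λ x → not (P x)) (h + h) (h + h) (inj₂ ≤-refl)
        B₁∪A₂ : zeros P f₃ h (h + h) ≡ zeros P f₃ (h + h) h + zeros P f₂ h h
        B₁∪A₂ = trans (zeros-split P f₃ h h h)
          (trans (cong (_+ zeros P f₃ (h + h) h) (S₂.untouched (λ x → not (P x)) h h (inj₁ ≤-refl)))
                 (+-comm (zeros P f₂ h h) (zeros P f₃ (h + h) h)))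
        B₁₁∪A₂₂ : zeros P f₆ (h + q) (q + q) ≡ zeros P f₆ (h + h) q + zeros P f₅ (h + q) q
        B₁₁∪A₂₂ = trans (zeros-split P f₆ (h + q) q q)
          (trans (cong₂ _+_ (S₅.untouched (λ x → not (P x)) (h + q) q (inj₁ (≤-reflexive h+q+q≡h+h)))
                            (cong (λ o → zeros P f₆ o q) h+q+q≡h+h))
                 (+-comm (zeros P f₅ (h + q) q) (zeros P f₆ (h + h) q)))

      zeros-left-in-B : zeros P f₇ (h + h) (h + h) ≡
                        (zeros P f₃ ((h + h) + h) h + zeros P f₆ ((h + h) + q) q) + zeros P f₇ ((h + q) + q) q
      zeros-left-in-B = begin
        zeros P f₇ (h + h) (h + h)                                                   ≡⟨ zeros-split P f₇ (h + h) h h ⟩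
        zeros P f₇ (h + h) (q + q) + zeros P f₇ ((h + h) + h) h                     ≡⟨ cong (_+ zeros P f₇ ((h + h) + h) h) (zeros-split P f₇ (h + h) q q) ⟩
        (zeros P f₇ (h + h) q + zeros P f₇ ((h + h) + q) q) + zeros P f₇ ((h + h) + h) h
          ≡⟨ cong₂ (λ x y → (x + y) + zeros P f₇ ((h + h) + h) h) (cong (λ o → zeros P f₇ o q) (sym h+q+q≡h+h)) B₁₂-final ⟩
        (zeros P f₇ ((h + q) + q) q + zeros P f₆ ((h + h) + q) q) + zeros P f₇ ((h + h) + h) h
          ≡⟨ cong (λ x → (zeros P f₇ ((h + q) + q) q + zeros P f₆ ((h + h) + q) q) + x) B₂-final ⟩
        (zeros P f₇ ((h + q) + q) q + zeros P f₆ ((h + h) + q) q) + zeros P f₃ ((h + h) + h) h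
          ≡⟨ reverse (zeros P f₇ ((h + q) + q) q) (zeros P f₆ ((h + h) + q) q) (zeros P f₃ ((h + h) + h) h) ⟩
        (zeros P f₃ ((h + h) + h) h + zeros P f₆ ((h + h) + q) q) + zeros P f₇ ((h + q) + q) q ∎
        where
        open ≡-Reasoning
        reverse : ∀ x y z → (x + y) + z ≡ (z + y) + x
        reverse x y z = trans (+-comm (x + y) z) (trans (cong (λ w → z + w) (+-comm x y)) (sym (+-assoc z y x)))
        B₁₂-final : zeros P f₇ ((h + h) + q) q ≡ zeros P f₆ ((h + h) + q) q
        B₁₂-final = S₆.untouched (λ x → not (P x)) ((h + h) + q) q (inj₂ (≤-reflexive h+q+2q≡h+h+q))
        B₂-final : zeros P f₇ ((h + h) + h) h ≡ zeros P f₃ ((h + h) + h) h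
        B₂-final = trans (S₆.untouched (λ x → not (P x)) ((h + h) + h) h
                           (inj₂ (≤-trans (≤-reflexive h+q+2q≡h+h+q) (+-monoʳ-≤ (h + h) (m≤m+n q q)))))
          (trans (S₅.untouched (λ x → not (P x)) ((h + h) + h) h (inj₂ ≤-refl))
          (trans (S₄.untouched (λ x → not (P x)) ((h + h) + h) h (inj₂ (m≤m+n (h + h) h)))
                 (S₃.untouched (λ x → not (P x)) ((h + h) + h) h (inj₂ (≤-reflexive (sym (+-assoc h h h)))))))

    attenuateStep-zeroOneHalver : ZeroOneHalver E (h + h) (K ++ attenuateStep Nh Ah Nq Aq h q)
    attenuateStep-zeroOneHalver P mono f = ones-bound , zeros-bound
      where
      open Stages P mono f

      ones-bound : ones P f 0 L ≤ h + h →
                   ℕtoℚ (ones P (run (K ++ attenuateStep Nh Ah Nq Aq h q) f) 0 (h + h)) ℚ.≤ E ℚ.* ℕtoℚ (ones P f 0 L)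
      ones-bound s≤4q = subst (λ g → ℕtoℚ (ones P g 0 (h + h)) ℚ.≤ E ℚ.* ℕtoℚ (ones P f 0 L)) (sym run≡f₇)
        (subst (λ x → ℕtoℚ x ℚ.≤ E ℚ.* ℕtoℚ (ones P f 0 L)) (sym ones-left-in-A)
          (attenuation-bound α≥0 α≤⅛ E≥0 E≤⅛ 3α²≤E q>0′ (ones-counts s≤4q)))

      zeros-bound : zeros P f 0 L ≤ h + h →
                    ℕtoℚ (zeros P (run (K ++ attenuateStep Nh Ah Nq Aq h q) f) (h + h) (h + h)) ℚ.≤ E ℚ.* ℕtoℚ (zeros P f 0 L)
      zeros-bound s≤4q = subst (λ g → ℕtoℚ (zeros P g (h + h) (h + h)) ℚ.≤ E ℚ.* ℕtoℚ (zeros P f 0 L)) (sym run≡f₇)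
        (subst (λ x → ℕtoℚ x ℚ.≤ E ℚ.* ℕtoℚ (zeros P f 0 L)) (sym zeros-left-in-B)
          (attenuation-bound α≥0 α≤⅛ E≥0 E≤⅛ 3α²≤E q>0′ (zeros-counts s≤4q)))

module AttenuateInduction where

  open import Data.Nat using (suc; _+_; _^_)
  open import Data.Nat.Properties using (+-identityʳ; m^n>0)
  open import Data.List using (_++_)
  open import Data.Integer using (+_)
  open import Data.Rational as ℚ using (ℚ; 0ℚ; _/_)
  open import Relation.Binary.PropositionalEquality using (_≡_; cong; cong₂; trans; subst; subst₂; sym)
  open import Defs
  open Networks
  open ZeroOneHalvers
  open BubbleSort
  open AttenuateStep

  private
    2^suc : ∀ n → 2 ^ suc n ≡ 2 ^ n + 2 ^ n
    2^suc n = cong (λ x → 2 ^ n + x) (+-identityʳ (2 ^ n))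

    resize : ∀ β N {n n′} → n ≡ n′ → ZeroOneHalver β n N → ZeroOneHalver β n′ N
    resize β N = subst (λ w → ZeroOneHalver β w N)

    rewire : ∀ N {n n′} → n ≡ n′ → OnWires (n + n) N → OnWires (n′ + n′) N
    rewire N = subst (λ w → OnWires (w + w) N)

  OnWires-attenuate : ∀ H k → OnWires (2 ^ k + 2 ^ k) (attenuate H k)
  OnWires-attenuate H 0 = OnWires-bubbleRounds 1 2
  OnWires-attenuate H 1 = OnWires-bubbleRounds 3 4
  OnWires-attenuate H 2 = OnWires-bubbleRounds 7 8
  OnWires-attenuate H 3 = OnWires-bubbleRounds 15 16
  OnWires-attenuate H (suc (suc (suc (suc i)))) =
    subst₂ (λ w h → OnWires (w + w) (attenuateStep (toNet (H j)) (attenuate H j) (toNet (H l)) (attenuate H l) h q))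
      (sym 2^j+1≡4q) (sym (2^suc l))
      (OnWires-attenuateStep q (rewire (toNet (H j)) (2^suc l) (OnWires-toNet (H j)))
                               (rewire (attenuate H j) (2^suc l) (OnWires-attenuate H (suc (suc (suc i)))))
                               (OnWires-toNet (H l)) (OnWires-attenuate H (suc (suc i))))
    where
    j = suc (suc (suc i))
    l = suc (suc i)
    q = 2 ^ l
    2^j+1≡4q : 2 ^ suc j ≡ (q + q) + (q + q)
    2^j+1≡4q = trans (2^suc j) (cong₂ _+_ (2^suc l) (2^suc l))

  OnWires-halveThenAttenuate : ∀ H k → OnWires (2 ^ k + 2 ^ k) (halveThenAttenuate H k)
  OnWires-halveThenAttenuate H k = OnWires-++ (toNet (H k)) (attenuate H k) (OnWires-toNet (H k)) (OnWires-attenuate H k)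

  module _ {α E : ℚ} (α≥0 : 0ℚ ℚ.≤ α) (α≤⅛ : α ℚ.≤ + 1 / 8) (E≥0 : 0ℚ ℚ.≤ E) (E≤⅛ : E ℚ.≤ + 1 / 8)
           (3α²≤E : + 3 / 1 ℚ.* (α ℚ.* α) ℚ.≤ E)
           (H : HalverFamily) (H-half : ∀ k → ZeroOneHalver α (2 ^ k) (toNet (H k))) where

    private
      halveThenBubble : ∀ n N → OnWires (suc n + suc n) N →
                        ZeroOneHalver E (suc n) (N ++ bubbleRounds (suc n + suc n) (suc n + suc n))
      halveThenBubble n N N-on = ZeroOneHalver-prefix {E} {suc n} N N-on (bubble-zeroOneHalver n E≥0)

    halveThenAttenuate-zeroOneHalver : ∀ k → ZeroOneHalver E (2 ^ k) (halveThenAttenuate H k)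
    halveThenAttenuate-zeroOneHalver 0 = halveThenBubble 0 (toNet (H 0)) (OnWires-toNet (H 0))
    halveThenAttenuate-zeroOneHalver 1 = halveThenBubble 1 (toNet (H 1)) (OnWires-toNet (H 1))
    halveThenAttenuate-zeroOneHalver 2 = halveThenBubble 3 (toNet (H 2)) (OnWires-toNet (H 2))
    halveThenAttenuate-zeroOneHalver 3 = halveThenBubble 7 (toNet (H 3)) (OnWires-toNet (H 3))
    halveThenAttenuate-zeroOneHalver (suc (suc (suc (suc i)))) =
      subst₂ (λ w h → ZeroOneHalver E w (toNet (H (suc j)) ++ attenuateStep (toNet (H j)) (attenuate H j)
                                                                          (toNet (H l)) (attenuate H l) h q))
        (sym 2^j+1≡4q) (sym (2^suc l))
        (Step.attenuateStep-zeroOneHalver α≥0 α≤⅛ E≥0 E≤⅛ 3α²≤E q (m^n>0 2 l)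
          (toNet (H (suc j))) (toNet (H j)) (attenuate H j) (toNet (H l)) (attenuate H l)
          (resize α (toNet (H (suc j))) 2^j+1≡4q (H-half (suc j))) (rewire (toNet (H (suc j))) 2^j+1≡4q (OnWires-toNet (H (suc j))))
          (resize α (toNet (H j)) (2^suc l) (H-half j)) (rewire (toNet (H j)) (2^suc l) (OnWires-toNet (H j)))
          (resize E (halveThenAttenuate H j) (2^suc l) (halveThenAttenuate-zeroOneHalver (suc (suc (suc i)))))
          (rewire (halveThenAttenuate H j) (2^suc l) (OnWires-halveThenAttenuate H j))
          (H-half l) (OnWires-toNet (H l))
          (halveThenAttenuate-zeroOneHalver (suc (suc i))) (OnWires-halveThenAttenuate H l))
      where
      j = suc (suc (suc i))
      l = suc (suc i)
      q = 2 ^ l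
      2^j+1≡4q : 2 ^ suc j ≡ (q + q) + (q + q)
      2^j+1≡4q = trans (2^suc j) (cong₂ _+_ (2^suc l) (2^suc l))

open import Defs
open import Data.Nat using (ℕ; _+_; _^_)
open import Data.Integer using (+_)
open import Data.Rational using (ℚ; _/_; _*_; _≤_; _<_; 0ℚ)

import Data.Nat as ℕ
import Data.Nat.Properties as ℕ
import Data.Integer as ℤ
import Data.Rational as ℚ
import Data.Rational.Properties as ℚ
open import Data.Product using (_,_)
open import Data.Empty using (⊥-elim)
open import Relation.Nullary using (yes; no)
open import Data.List using (_∷_; [])
open import Relation.Binary.PropositionalEquality using (refl)
open import Tactic.RingSolver using (solve)
open RationalArith
open Networks using (OnWires-toNet)
open ZeroOneHalvers using (zeroOneHalver⇒isHalver; isHalver⇒zeroOneHalver)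
open AttenuateInduction using (halveThenAttenuate-zeroOneHalver; OnWires-halveThenAttenuate)

module _ {α : ℚ} (α≥0 : 0ℚ ≤ α) (α≤⅛ : α ≤ + 1 / 8) where

  private
    ⅛-α≥0 : 0ℚ ≤ + 1 / 8 ℚ.- α
    ⅛-α≥0 = slack α≤⅛

    α*n<1 : ∀ {n} → n ℕ.≤ 4 → α * ℕtoℚ n < ℚ.1ℚ
    α*n<1 n≤4 = ℚ.≤-<-trans (ℚ.≤-trans (*-monoˡ-≤-0≤ α≥0 (ℕtoℚ-mono-≤ n≤4)) 4α≤½) ½<1
      where
      4α≤½ : α * ℕtoℚ 4 ≤ + 1 / 2
      4α≤½ = ≤-by-slack (ℕtoℚ-nonNeg 4 ⊗ ⅛-α≥0) (solve (α ∷ []) ℚ-ring)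
      ½<1 : + 1 / 2 < ℚ.1ℚ
      ½<1 = ℚ.*<* (ℤ.+<+ (ℕ.s≤s (ℕ.s≤s ℕ.z≤n)))

  -- The bound α²(m + 3) enters only through m ≥ 3, which α ≤ 1/8 forces.
  ceilLog2Inv≥3 : ∀ {m} → IsCeilLog2Inv α m → 3 ℕ.≤ m
  ceilLog2Inv≥3 {m} (1≤α2^m , _) with 3 ℕ.≤? m
  ... | yes 3≤m = 3≤m
  ... | no  3≰m = ⊥-elim (ℚ.<-irrefl refl (ℚ.≤-<-trans 1≤α2^m (α*n<1 (ℕ.^-monoʳ-≤ 2 (ℕ.s≤s⁻¹ (ℕ.≰⇒> 3≰m))))))

  6α²≥0 : 0ℚ ≤ + 6 / 1 * (α * α)
  6α²≥0 = n/d-nonNeg 6 1 ⊗ α≥0 ⊗ α≥0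

  6α²≤⅛ : + 6 / 1 * (α * α) ≤ + 1 / 8
  6α²≤⅛ = ≤-by-slack ((n/d-nonNeg 6 1 ⊗ α≥0) ⊗ ⅛-α≥0 ⊕ n/d-nonNeg 3 4 ⊗ ⅛-α≥0 ⊕ n/d-nonNeg 1 32) (solve (α ∷ []) ℚ-ring)

  3α²≤6α² : + 3 / 1 * (α * α) ≤ + 6 / 1 * (α * α)
  3α²≤6α² = ≤-by-slack (n/d-nonNeg 3 1 ⊗ α≥0 ⊗ α≥0) (solve (α ∷ []) ℚ-ring)

  6α²≤α²[m+3] : ∀ {m} → 3 ℕ.≤ m → + 6 / 1 * (α * α) ≤ α * α * ℕtoℚ (m + 3)
  6α²≤α²[m+3] 3≤m = ℚ.≤-trans (ℚ.≤-reflexive (solve (α ∷ []) ℚ-ring)) (*-monoˡ-≤-0≤ (α≥0 ⊗ α≥0) (ℕtoℚ-mono-≤ (ℕ.+-monoˡ-≤ 3 3≤m)))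

theorem4 : (α : ℚ) → 0ℚ < α → α ≤ (+ 1 / 8) →
    (H : HalverFamily) →
    (∀ k → IsHalver α (2 ^ k) (toNet (H k))) →
    (m : ℕ) → IsCeilLog2Inv α m →
    ∀ k → IsHalver (α * α * ℕtoℚ (m + 3)) (2 ^ k) (halveThenAttenuate H k)
theorem4 α 0<α α≤⅛ H H-halves m ceil k =
  zeroOneHalver⇒isHalver (2 ^ k) (halveThenAttenuate H k) (6α²≥0 α≥0 α≤⅛)
    (6α²≤α²[m+3] α≥0 α≤⅛ (ceilLog2Inv≥3 α≥0 α≤⅛ ceil)) (OnWires-halveThenAttenuate H k)
    (halveThenAttenuate-zeroOneHalver α≥0 α≤⅛ (6α²≥0 α≥0 α≤⅛) (6α²≤⅛ α≥0 α≤⅛) (3α²≤6α² α≥0 α≤⅛) H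
      (λ j → isHalver⇒zeroOneHalver {α} (2 ^ j) (toNet (H j)) (OnWires-toNet (H j)) (H-halves j)) k)
  where
  α≥0 : 0ℚ ≤ α
  α≥0 = ℚ.<⇒≤ 0<α
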